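{- If $n$ is sufficiently large, then $$\mathrm{ex}(n,T_1,C_4)=\mathcal{N}(T_1,F(n))=\begin{cases}\binom{n}{2}-\frac{3(n-1)}{2} & \text{if } n \text{ is odd},\\ \binom{n}{2}-2n+3 & \text{if } n \text{ is even}.\end{cases}$$
   Context: $T_1$ (the paw) is the graph on $4$ vertices consisting of a triangle together with one further vertex joined to exactly one vertex of the triangle. $C_4$ is the cycle on $4$ vertices. The friendship graph $F(n)$ is the $n$-vertex graph with a vertex $v$ of degree $n-1$ together with a matching of $\lfloor (n-1)/2\rfloor$ edges on the other $n-1$ vertices. $\mathcal{N}(H,G)$ is the number of subgraphs of $G$ isomorphic to $H$; $\mathrm{ex}(n,H,F)$ is the maximum of $\mathcal{N}(H,G)$ over $F$-free $n$-vertex graphs $G$. -}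

module Defs where

open import Data.Bool using (Bool; true; false; _∧_; _∨_; not; if_then_else_)
open import Data.Nat using (ℕ; zero; suc; _+_; _*_; _∸_; _≡ᵇ_; _/_; NonZero)
open import Data.Fin using (Fin; toℕ)
open import Data.Fin.Properties using (_≟_)
open import Data.List using (List; []; _∷_; map; concatMap; allFin; length; filterᵇ)
open import Data.Bool.ListAction using (and)
open import Data.Vec.Functional as VF using (Vector)
open import Relation.Nullary.Decidable using (⌊_⌋)
open import Relation.Binary.PropositionalEquality using (_≡_; refl; cong; cong₂) renaming (sym to ≡-sym)
open import Relation.Nullary using (yes; no)
open import Data.Empty using (⊥-elim)
open import Data.Bool.Properties using (∨-comm)

record Graph (n : ℕ) : Set where
  field
    adj    : Fin n → Fin n → Bool
    sym    : ∀ i j → adj i j ≡ adj j i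
    irrefl : ∀ i → adj i i ≡ false
open Graph public

allMaps : (k n : ℕ) → List (Vector (Fin n) k)
allMaps zero    n = VF.[] ∷ []
allMaps (suc k) n = concatMap (λ x → map (λ f → x VF.∷ f) (allMaps k n)) (allFin n)

isEmb : {k n : ℕ} → Graph k → Graph n → (Fin k → Fin n) → Bool
isEmb {k} H G f =
  and (concatMap (λ i → map (λ j →
        (⌊ i ≟ j ⌋ ∨ not ⌊ f i ≟ f j ⌋) ∧ (not (adj H i j) ∨ adj G (f i) (f j)))
      (allFin k)) (allFin k))

embCount : {k n : ℕ} → Graph k → Graph n → ℕ
embCount {k} {n} H G = length (filterᵇ (isEmb H G) (allMaps k n))

-- N(H,G): number of subgraphs of G isomorphic to H
--   = #embeddings of H into G / #automorphisms of H.
N : {k n : ℕ} (H : Graph k) (G : Graph n) → .{{_ : NonZero (embCount H H)}} → ℕ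
N H G = embCount H G / embCount H H

Free : {k n : ℕ} → Graph k → Graph n → Set
Free H G = embCount H G ≡ 0

eqF : {n : ℕ} → Fin n → Fin n → Bool
eqF i j = ⌊ i ≟ j ⌋

eqF-sym : {n : ℕ} (i j : Fin n) → eqF i j ≡ eqF j i
eqF-sym i j with i ≟ j | j ≟ i
... | yes _ | yes _ = refl
... | no _  | no _  = refl
... | yes p | no q  = ⊥-elim (q (≡-sym p))
... | no p  | yes q = ⊥-elim (p (≡-sym q))

eqF-refl : {n : ℕ} (i : Fin n) → eqF i i ≡ true
eqF-refl i with i ≟ i
... | yes _ = refl
... | no q  = ⊥-elim (q refl)

mkGraph : {n : ℕ} → (ℕ → ℕ → Bool) → Graph n
mkGraph E = record
  { adj    = λ i j → not (eqF i j) ∧ (E (toℕ i) (toℕ j) ∨ E (toℕ j) (toℕ i))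
  ; sym    = λ i j → cong₂ (λ a b → not a ∧ b) (eqF-sym i j) (∨-comm (E (toℕ i) (toℕ j)) _)
  ; irrefl = λ i → cong (λ a → not a ∧ (E (toℕ i) (toℕ i) ∨ E (toℕ i) (toℕ i))) (eqF-refl i)
  }

pawE : ℕ → ℕ → Bool
pawE 0 1 = true
pawE 1 2 = true
pawE 0 2 = true
pawE 2 3 = true
pawE _ _ = false

T₁ : Graph 4
T₁ = mkGraph pawE

c4E : ℕ → ℕ → Bool
c4E 0 1 = true
c4E 1 2 = true
c4E 2 3 = true
c4E 0 3 = true
c4E _ _ = false

C₄ : Graph 4
C₄ = mkGraph c4E

-- Friendship graph F(n): vertex 0 adjacent to all others; on 1..n-1 the matching
-- {1,2},{3,4},...,  i.e. i,j ≥ 1 (i ≠ j) adjacent iff (i-1)/2 = (j-1)/2.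
-- Since vertices are < n this gives exactly ⌊(n-1)/2⌋ matching edges.
friendE : ℕ → ℕ → Bool
friendE zero    (suc j) = true
friendE (suc i) (suc j) = (i / 2) ≡ᵇ (j / 2)
friendE _       _       = false

F : (n : ℕ) → Graph n
F n = mkGraph friendE

-- A paw is counted through the ordered pair (y, z) of one of its two degree-2 triangle vertices and
-- its pendant vertex.  In a C₄-free graph two vertices have at most one common neighbour, so every
-- such pair carries at most one paw and adjacent pairs carry none.  If all degrees are at most 7,
-- at most 49n pairs carry a paw.  Otherwise split the vertices into a vertex v of degree Δ ≥ 8, its
-- neighbourhood N and the r remaining vertices R, and bound the pairs block by block: y ∈ N carries
-- at most Δ − 2 pairs inside N, and none if it has no neighbour in N; at most 1 + deg_R(z) vertices
-- of N reach a given z ∈ R; and R carries nothing towards N when r ≤ 1.  Since the edges inside N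
-- come in pairs, the total is at most 2⌊(n−1)/2⌋(n−3), the paw count of the C₄-free friendship
-- graph F(n).
module Submission where

open import Defs hiding (sym)
open import Data.Bool.Base using (Bool; true; false; _∧_; _∨_; not; T)
open import Data.Bool.ListAction using (and)
open import Data.Bool.Properties using (T-∧; T-∨; T-≡)
open import Data.Empty using (⊥; ⊥-elim)
open import Data.Fin.Base using (Fin; zero; suc; toℕ; fromℕ<)
open import Data.Fin.Properties as Finₚ using (_≟_; all?; ¬∀⟶∃¬; toℕ-injective; toℕ-fromℕ<)
open import Data.List.Base using (List; []; _∷_; _++_; map; concatMap; tabulate; length; filterᵇ)
open import Data.List.Properties using (length-++; filter-++)
open import Data.List.Relation.Unary.All using (All; []; _∷_)
open import Data.List.Relation.Unary.All.Properties using (map⁺; map⁻; concat⁺; concat⁻; tabulate⁺; tabulate⁻)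
open import Data.Nat.Base using (ℕ; zero; suc; _+_; _*_; _∸_; _/_; _%_; _≤_; _≰_; _<_; _<ᵇ_; z≤n; s≤s; >-nonZero)
open import Data.Nat.Combinatorics using (_C_; nC1≡n; nCk+nC[k+1]≡[n+1]C[k+1])
open import Data.Nat.DivMod using (m≡m%n+[m/n]*n; m%n<n; m*n/n≡m; /-monoˡ-≤; m/n≡1+[m∸n]/n)
open import Data.Nat.Properties hiding (_≟_)
open import Data.Nat.Tactic.RingSolver using (solve-∀)
open import Data.Product.Base using (∃; ∃₂; _×_; _,_; proj₁; proj₂; map₂)
open import Data.Sum.Base using (_⊎_; inj₁; inj₂)
open import Data.Vec.Functional as Vector using (Vector)
open import Function.Base using (_∘_)
open import Function.Bundles using (Equivalence)
open import Relation.Binary.PropositionalEquality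
open import Relation.Nullary using (¬_; Dec; yes; no; contradiction; ⌊_⌋)
open import Relation.Nullary.Decidable using (T?; dec-false; isYes≗does; ⌊⌋-map′)
open import Algebra.Properties.Semiring.Sum +-*-semiring
  using (sum; sum-syntax; sum-cong-≗; ∑-distrib-+; ∑-comm; sum-replicate-zero; *-distribˡ-sum; *-distribʳ-sum)

-- Indicators and finite sums

𝟙 : Bool → ℕ
𝟙 true  = 1
𝟙 false = 0

𝟙≤1 : ∀ b → 𝟙 b ≤ 1
𝟙≤1 true  = ≤-refl
𝟙≤1 false = z≤n

𝟙-pos : ∀ {b} → 0 < 𝟙 b → b ≡ true
𝟙-pos {true} _ = refl

𝟙-false : ∀ {b} → b ≢ true → 𝟙 b ≡ 0
𝟙-false {false} _      = refl
𝟙-false {true}  b≢true = contradiction refl b≢true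

𝟙*𝟙-pos : ∀ b c → 0 < 𝟙 b * 𝟙 c → b ≡ true × c ≡ true
𝟙*𝟙-pos true true _ = refl , refl

𝟙*𝟙≤1 : ∀ b c → 𝟙 b * 𝟙 c ≤ 1
𝟙*𝟙≤1 true  c = ≤-trans (≤-reflexive (+-identityʳ (𝟙 c))) (𝟙≤1 c)
𝟙*𝟙≤1 false c = z≤n

∑-mono-≤ : ∀ {n} {f g : Fin n → ℕ} → (∀ i → f i ≤ g i) → sum f ≤ sum g
∑-mono-≤ {zero}  _   = z≤n
∑-mono-≤ {suc n} f≤g = +-mono-≤ (f≤g zero) (∑-mono-≤ (f≤g ∘ suc))

∑-zero : ∀ {n} {f : Fin n → ℕ} → (∀ i → f i ≡ 0) → sum f ≡ 0
∑-zero {n} f≡0 = trans (sum-cong-≗ f≡0) (sum-replicate-zero n)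

∑-const : ∀ n c → ∑[ i < n ] c ≡ n * c
∑-const zero    c = refl
∑-const (suc n) c = cong (c +_) (∑-const n c)

term≤∑ : ∀ {n} (f : Fin n → ℕ) i → f i ≤ sum f
term≤∑ f zero    = m≤m+n (f zero) _
term≤∑ f (suc i) = ≤-trans (term≤∑ (f ∘ suc) i) (m≤n+m _ (f zero))

two-terms≤∑ : ∀ {n} (f : Fin n → ℕ) {i j} → i ≢ j → f i + f j ≤ sum f
two-terms≤∑ f {zero}  {zero}  i≢j = contradiction refl i≢j
two-terms≤∑ f {zero}  {suc j} _   = +-monoʳ-≤ (f zero) (term≤∑ (f ∘ suc) j)
two-terms≤∑ f {suc i} {zero}  _   =
  subst (_≤ sum f) (+-comm (f zero) (f (suc i))) (+-monoʳ-≤ (f zero) (term≤∑ (f ∘ suc) i))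
two-terms≤∑ f {suc i} {suc j} i≢j =
  ≤-trans (two-terms≤∑ (f ∘ suc) (i≢j ∘ cong suc)) (m≤n+m _ (f zero))

∑-pos : ∀ {n} (f : Fin n → ℕ) → 0 < sum f → ∃ λ i → 0 < f i
∑-pos {suc n} f pos with 0 <? f zero
... | yes f₀>0 = zero , f₀>0
... | no  f₀≯0 with ∑-pos (f ∘ suc) (subst (λ x → 0 < x + sum (f ∘ suc)) (n≤0⇒n≡0 (≮⇒≥ f₀≯0)) pos)
...   | i , fᵢ>0 = suc i , fᵢ>0

∑≤1 : ∀ {n} (f : Fin n → ℕ) → (∀ i → f i ≤ 1) → (∀ i j → 0 < f i → 0 < f j → i ≡ j) →
      sum f ≤ 1
∑≤1 {zero}  f _   _    = z≤n
∑≤1 {suc n} f f≤1 uniq with 0 <? f zero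
... | no f₀≯0 = subst (λ x → x + sum (f ∘ suc) ≤ 1) (sym (n≤0⇒n≡0 (≮⇒≥ f₀≯0)))
      (∑≤1 (f ∘ suc) (f≤1 ∘ suc) (λ i j fᵢ>0 fⱼ>0 → Finₚ.suc-injective (uniq _ _ fᵢ>0 fⱼ>0)))
... | yes f₀>0 = subst (λ x → f zero + x ≤ 1) (sym rest≡0) (subst (_≤ 1) (sym (+-identityʳ _)) (f≤1 zero))
  where
  rest≡0 : sum (f ∘ suc) ≡ 0
  rest≡0 = ∑-zero λ i → n≤0⇒n≡0 (≮⇒≥ λ fᵢ>0 → contradiction (uniq zero (suc i) f₀>0 fᵢ>0) λ ())

∑-δ : ∀ {n} (i : Fin n) (g : Fin n → ℕ) → ∑[ j < n ] (𝟙 ⌊ j ≟ i ⌋ * g j) ≡ g i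
∑-δ {suc n} zero g = trans (cong₂ _+_ (+-identityʳ (g zero)) (∑-zero {f = rest} λ _ → refl)) (+-identityʳ (g zero))
  where
  rest : Fin n → ℕ
  rest j = 𝟙 ⌊ suc j ≟ zero ⌋ * g (suc j)
∑-δ         (suc i) g = trans (sum-cong-≗ λ j → cong (λ b → 𝟙 b * g (suc j)) (⌊suc≟suc⌋ j))
                             (∑-δ i (g ∘ suc))
  where
  ⌊suc≟suc⌋ : ∀ j → ⌊ suc j ≟ suc i ⌋ ≡ ⌊ j ≟ i ⌋
  ⌊suc≟suc⌋ j = ⌊⌋-map′ (cong suc) Finₚ.suc-injective (j ≟ i)

∑-δ₁ : ∀ {n} (i : Fin n) → ∑[ j < n ] 𝟙 ⌊ j ≟ i ⌋ ≡ 1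
∑-δ₁ i = trans (sum-cong-≗ λ j → sym (*-identityʳ (𝟙 ⌊ j ≟ i ⌋))) (∑-δ i (λ _ → 1))

∑-except₃ : ∀ {n} (f : Fin n → ℕ) p q s → (∀ x → x ≢ p → x ≢ q → x ≢ s → 0 < f x) →
            n ∸ 3 ≤ sum f
∑-except₃ {n} f p q s pos = begin
  n ∸ 3
    ≡⟨ cong (_∸ 3) (trans (sym (*-identityʳ n)) (sym (∑-const n 1))) ⟩
  ∑[ x < n ] 1 ∸ 3
    ≤⟨ ∸-monoˡ-≤ 3 (∑-mono-≤ covered) ⟩
  ∑[ x < n ] (f x + (δ p x + δ q x + δ s x)) ∸ 3
    ≡⟨ cong (_∸ 3) (∑-distrib-+ f (λ x → δ p x + δ q x + δ s x)) ⟩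
  sum f + ∑[ x < n ] (δ p x + δ q x + δ s x) ∸ 3
    ≡⟨ cong (λ t → sum f + t ∸ 3) (trans (∑-distrib-+ (λ x → δ p x + δ q x) (δ s))
         (cong₂ _+_ (trans (∑-distrib-+ (δ p) (δ q)) (cong₂ _+_ (∑-δ₁ p) (∑-δ₁ q))) (∑-δ₁ s))) ⟩
  sum f + 3 ∸ 3
    ≡⟨ m+n∸n≡m (sum f) 3 ⟩
  sum f ∎
  where
  open ≤-Reasoning
  δ : Fin n → Fin n → ℕ
  δ i j = 𝟙 ⌊ j ≟ i ⌋
  covered : ∀ x → 1 ≤ f x + (𝟙 ⌊ x ≟ p ⌋ + 𝟙 ⌊ x ≟ q ⌋ + 𝟙 ⌊ x ≟ s ⌋)
  covered x with x ≟ p | x ≟ q | x ≟ s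
  ... | yes _  | _      | _      = ≤-trans (s≤s z≤n) (m≤n+m _ (f x))
  ... | no _   | yes _  | _      = ≤-trans (s≤s z≤n) (m≤n+m _ (f x))
  ... | no _   | no _   | yes _  = ≤-trans (s≤s z≤n) (m≤n+m _ (f x))
  ... | no x≢p | no x≢q | no x≢s = ≤-trans (pos x x≢p x≢q x≢s) (m≤m+n (f x) _)

∑+2≤∑ : ∀ {n} {g h : Fin n → ℕ} → (∀ k → g k ≤ h k) →
        ∀ {i j} → i ≢ j → g i < h i → g j < h j → sum g + 2 ≤ sum h
∑+2≤∑ {n} {g} {h} g≤h {i} {j} i≢j gᵢ<hᵢ gⱼ<hⱼ = begin
  sum g + 2                 ≤⟨ +-monoʳ-≤ (sum g) (+-mono-≤ (gap gᵢ<hᵢ) (gap gⱼ<hⱼ)) ⟩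
  sum g + (d i + d j)       ≤⟨ +-monoʳ-≤ (sum g) (two-terms≤∑ d i≢j) ⟩
  sum g + sum d             ≡⟨ ∑-distrib-+ g d ⟨
  ∑[ k < n ] (g k + d k)    ≡⟨ sum-cong-≗ (λ k → m+[n∸m]≡n (g≤h k)) ⟩
  sum h                     ∎
  where
  open ≤-Reasoning
  d : Fin n → ℕ
  d k = h k ∸ g k
  gap : ∀ {k} → g k < h k → 1 ≤ d k
  gap = m+n≤o⇒m≤o∸n 1

∑∑-symmetric-even : ∀ {n} (h : Fin n → Fin n → ℕ) → (∀ i j → h i j ≡ h j i) → (∀ i → h i i ≡ 0) →
                    ∃ λ k → ∑[ i < n ] ∑[ j < n ] h i j ≡ 2 * k
∑∑-symmetric-even {zero}  h _         _    = 0 , refl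
∑∑-symmetric-even {suc n} h symmetric diag
  with ∑∑-symmetric-even (λ i j → h (suc i) (suc j)) (λ i j → symmetric (suc i) (suc j)) (diag ∘ suc)
... | k , eq = first-row + k , (begin
  (h zero zero + first-row) + ∑[ i < n ] (h (suc i) zero + ∑[ j < n ] h (suc i) (suc j))
    ≡⟨ cong₂ _+_ (cong (_+ first-row) (diag zero)) (∑-distrib-+ (λ i → h (suc i) zero) _) ⟩
  first-row + (∑[ i < n ] h (suc i) zero + ∑[ i < n ] ∑[ j < n ] h (suc i) (suc j))
    ≡⟨ cong₂ (λ a b → first-row + (a + b)) (sum-cong-≗ λ i → symmetric (suc i) zero) eq ⟩
  first-row + (first-row + 2 * k)
    ≡⟨ regroup first-row k ⟩
  2 * (first-row + k) ∎)
  where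
  open ≡-Reasoning
  first-row : ℕ
  first-row = ∑[ j < n ] h zero (suc j)
  regroup : ∀ a k → a + (a + 2 * k) ≡ 2 * (a + k)
  regroup = solve-∀

∑⟨_⟩_ : ∀ {n} → (Fin n → Bool) → (Fin n → ℕ) → ℕ
∑⟨ P ⟩ f = sum (λ i → 𝟙 (P i) * f i)

module _ {n} (P : Fin n → Bool) where

  ∑⟨⟩-mono-≤ : {f g : Fin n → ℕ} → (∀ i → P i ≡ true → f i ≤ g i) → ∑⟨ P ⟩ f ≤ ∑⟨ P ⟩ g
  ∑⟨⟩-mono-≤ {f} {g} f≤g = ∑-mono-≤ λ i → on i refl
    where
    on : ∀ i {b} → P i ≡ b → 𝟙 b * f i ≤ 𝟙 b * g i
    on i {true}  Pᵢ = +-monoˡ-≤ 0 (f≤g i Pᵢ)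
    on i {false} _  = z≤n

  ∑⟨⟩-zero : {f : Fin n → ℕ} → (∀ i → P i ≡ true → f i ≡ 0) → ∑⟨ P ⟩ f ≡ 0
  ∑⟨⟩-zero {f} f≡0 = ∑-zero λ i → on i refl
    where
    on : ∀ i {b} → P i ≡ b → 𝟙 b * f i ≡ 0
    on i {true}  Pᵢ = trans (+-identityʳ (f i)) (f≡0 i Pᵢ)
    on i {false} _  = refl

  ∑⟨⟩-const : ∀ c → ∑⟨ P ⟩ (λ _ → c) ≡ sum (𝟙 ∘ P) * c
  ∑⟨⟩-const c = sym (*-distribʳ-sum c (𝟙 ∘ P))

  ∑⟨⟩-δ : ∀ {i} → P i ≡ true → ∑⟨ P ⟩ (λ j → 𝟙 ⌊ j ≟ i ⌋) ≡ 1
  ∑⟨⟩-δ {i} Pᵢ = begin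
    ∑[ j < n ] (𝟙 (P j) * 𝟙 ⌊ j ≟ i ⌋)  ≡⟨ sum-cong-≗ (λ j → *-comm (𝟙 (P j)) _) ⟩
    ∑[ j < n ] (𝟙 ⌊ j ≟ i ⌋ * 𝟙 (P j))  ≡⟨ ∑-δ i (𝟙 ∘ P) ⟩
    𝟙 (P i)                             ≡⟨ cong 𝟙 Pᵢ ⟩
    1                                   ∎
    where open ≡-Reasoning

  ∑⟨⟩-+ : (f g : Fin n → ℕ) → ∑⟨ P ⟩ (λ i → f i + g i) ≡ ∑⟨ P ⟩ f + ∑⟨ P ⟩ g
  ∑⟨⟩-+ f g = trans (sum-cong-≗ λ i → *-distribˡ-+ (𝟙 (P i)) (f i) (g i))
                    (∑-distrib-+ (λ i → 𝟙 (P i) * f i) (λ i → 𝟙 (P i) * g i))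

  ∑⟨⟩-*ˡ : ∀ c (f : Fin n → ℕ) → ∑⟨ P ⟩ (λ i → c * f i) ≡ c * ∑⟨ P ⟩ f
  ∑⟨⟩-*ˡ c f = trans (sum-cong-≗ λ i → swap (𝟙 (P i)) c (f i))
                     (sym (*-distribˡ-sum c (λ i → 𝟙 (P i) * f i)))
    where
    swap : ∀ a b c → a * (b * c) ≡ b * (a * c)
    swap = solve-∀

∑⟨⟩-comm : ∀ {m n} (P : Fin m → Bool) (Q : Fin n → Bool) (f : Fin m → Fin n → ℕ) →
           ∑⟨ P ⟩ (λ i → ∑⟨ Q ⟩ (f i)) ≡ ∑⟨ Q ⟩ (λ j → ∑⟨ P ⟩ (λ i → f i j))
∑⟨⟩-comm {m} {n} P Q f = begin
  ∑[ i < m ] (𝟙 (P i) * ∑[ j < n ] (𝟙 (Q j) * f i j))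
    ≡⟨ sum-cong-≗ (λ i → *-distribˡ-sum (𝟙 (P i)) (λ j → 𝟙 (Q j) * f i j)) ⟩
  ∑[ i < m ] ∑[ j < n ] (𝟙 (P i) * (𝟙 (Q j) * f i j))
    ≡⟨ ∑-comm (λ i j → 𝟙 (P i) * (𝟙 (Q j) * f i j)) ⟩
  ∑[ j < n ] ∑[ i < m ] (𝟙 (P i) * (𝟙 (Q j) * f i j))
    ≡⟨ sum-cong-≗ (λ j → sum-cong-≗ λ i → swap (𝟙 (P i)) (𝟙 (Q j)) (f i j)) ⟩
  ∑[ j < n ] ∑[ i < m ] (𝟙 (Q j) * (𝟙 (P i) * f i j))
    ≡⟨ sum-cong-≗ (λ j → *-distribˡ-sum (𝟙 (Q j)) (λ i → 𝟙 (P i) * f i j)) ⟨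
  ∑[ j < n ] (𝟙 (Q j) * ∑[ i < m ] (𝟙 (P i) * f i j))   ∎
  where
  open ≡-Reasoning
  swap : ∀ a b c → a * (b * c) ≡ b * (a * c)
  swap = solve-∀

-- Counting embeddings of four-vertex graphs

⟨_,_,_,_⟩ : ∀ {A : Set} → A → A → A → A → Vector A 4
⟨ a , b , c , d ⟩ = a Vector.∷ (b Vector.∷ (c Vector.∷ (d Vector.∷ Vector.[])))

module _ {A : Set} (p : A → Bool) where

  length-filterᵇ-singleton : ∀ x → length (filterᵇ p (x ∷ [])) ≡ 𝟙 (p x)
  length-filterᵇ-singleton x with p x
  ... | true  = refl
  ... | false = refl

  length-filterᵇ-++ : ∀ xs ys → length (filterᵇ p (xs ++ ys)) ≡ length (filterᵇ p xs) + length (filterᵇ p ys)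
  length-filterᵇ-++ xs ys = trans (cong length (filter-++ (T? ∘ p) xs ys)) (length-++ (filterᵇ p xs))

  length-filterᵇ-concatMap : ∀ {B : Set} {n} (g : B → List A) (f : Fin n → B) →
    length (filterᵇ p (concatMap g (tabulate f))) ≡ ∑[ i < n ] length (filterᵇ p (g (f i)))
  length-filterᵇ-concatMap {n = zero}  g f = refl
  length-filterᵇ-concatMap {n = suc n} g f =
    trans (length-filterᵇ-++ (g (f zero)) _) (cong (_ +_) (length-filterᵇ-concatMap g (f ∘ suc)))

length-filterᵇ-map : ∀ {A B : Set} (p : B → Bool) (f : A → B) xs →
  length (filterᵇ p (map f xs)) ≡ length (filterᵇ (p ∘ f) xs)
length-filterᵇ-map p f []       = refl
length-filterᵇ-map p f (x ∷ xs) with p (f x)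
... | true  = cong suc (length-filterᵇ-map p f xs)
... | false = length-filterᵇ-map p f xs

length-filterᵇ-allMaps : ∀ k n (p : Vector (Fin n) (suc k) → Bool) →
  length (filterᵇ p (allMaps (suc k) n)) ≡ ∑[ x < n ] length (filterᵇ (p ∘ (x Vector.∷_)) (allMaps k n))
length-filterᵇ-allMaps k n p =
  trans (length-filterᵇ-concatMap p (λ x → map (x Vector.∷_) (allMaps k n)) (λ x → x))
        (sum-cong-≗ λ x → length-filterᵇ-map p (x Vector.∷_) (allMaps k n))

embCount≡∑⁴ : ∀ {n} (H : Graph 4) (G : Graph n) →
  embCount H G ≡ ∑[ a < n ] ∑[ b < n ] ∑[ c < n ] ∑[ d < n ] 𝟙 (isEmb H G ⟨ a , b , c , d ⟩)
embCount≡∑⁴ {n} H G =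
  trans (length-filterᵇ-allMaps 3 n (isEmb H G)) (sum-cong-≗ λ a →
  trans (length-filterᵇ-allMaps 2 n (λ f → isEmb H G (a Vector.∷ f))) (sum-cong-≗ λ b →
  trans (length-filterᵇ-allMaps 1 n (λ f → isEmb H G (a Vector.∷ (b Vector.∷ f)))) (sum-cong-≗ λ c →
  trans (length-filterᵇ-allMaps 0 n (λ f → isEmb H G (a Vector.∷ (b Vector.∷ (c Vector.∷ f))))) (sum-cong-≗ λ d →
  length-filterᵇ-singleton (λ f → isEmb H G (a Vector.∷ (b Vector.∷ (c Vector.∷ (d Vector.∷ f))))) Vector.[]))))

and⁺ : ∀ bs → T (and bs) → All T bs
and⁺ []          _ = []
and⁺ (true ∷ bs) t = _ ∷ and⁺ bs t

and⁻ : ∀ {bs} → All T bs → T (and bs)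
and⁻ []                  = _
and⁻ {true ∷ _} (_ ∷ ts) = and⁻ ts

module _ {k n} (H : Graph k) (G : Graph n) (f : Fin k → Fin n) where

  private
    pairOK : Fin k → Fin k → Bool
    pairOK i j = (⌊ i ≟ j ⌋ ∨ not ⌊ f i ≟ f j ⌋) ∧ (not (adj H i j) ∨ adj G (f i) (f j))

    isEmb⇒pairOK : isEmb H G f ≡ true → ∀ i j → T (pairOK i j)
    isEmb⇒pairOK e i j =
      tabulate⁻ (map⁻ (tabulate⁻ (map⁻ (concat⁻ (and⁺ _ (Equivalence.from T-≡ e)))) i)) j

    pairOK⇒isEmb : (∀ i j → T (pairOK i j)) → isEmb H G f ≡ true
    pairOK⇒isEmb ok =
      Equivalence.to T-≡ (and⁻ (concat⁺ (map⁺ (tabulate⁺ λ i → map⁺ (tabulate⁺ (ok i))))))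

  isEmb-adj : isEmb H G f ≡ true → ∀ {i j} → adj H i j ≡ true → adj G (f i) (f j) ≡ true
  isEmb-adj e {i} {j} Hij = Equivalence.to T-≡
    (subst (λ b → T (not b ∨ adj G (f i) (f j))) Hij (proj₂ (Equivalence.to T-∧ (isEmb⇒pairOK e i j))))

  isEmb-inj : isEmb H G f ≡ true → ∀ {i j} → i ≢ j → f i ≢ f j
  isEmb-inj e {i} {j} i≢j with i ≟ j | f i ≟ f j | isEmb⇒pairOK e i j
  ... | yes i≡j | _         | _  = contradiction i≡j i≢j
  ... | no _    | yes _     | ()
  ... | no _    | no fi≢fj  | _  = fi≢fj

  isEmb-intro : (∀ i j → i ≢ j → f i ≢ f j) → (∀ i j → adj H i j ≡ true → adj G (f i) (f j) ≡ true) →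
                isEmb H G f ≡ true
  isEmb-intro inj preserves = pairOK⇒isEmb ok
    where
    edge-ok : ∀ i j → T (not (adj H i j) ∨ adj G (f i) (f j))
    edge-ok i j with adj H i j in Hij
    ... | false = _
    ... | true  = Equivalence.from T-≡ (preserves i j Hij)
    ok : ∀ i j → T (pairOK i j)
    ok i j with i ≟ j | f i ≟ f j
    ... | yes _   | _         = edge-ok i j
    ... | no i≢j  | yes fi≡fj = contradiction fi≡fj (inj i j i≢j)
    ... | no _    | no _      = edge-ok i j

⟨⟩-injective : ∀ {n} {a b c d : Fin n} → a ≢ b → a ≢ c → a ≢ d → b ≢ c → b ≢ d → c ≢ d →
               ∀ i j → i ≢ j → ⟨ a , b , c , d ⟩ i ≢ ⟨ a , b , c , d ⟩ j
⟨⟩-injective ab ac ad bc bd cd zero                   (suc zero)             _ = ab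
⟨⟩-injective ab ac ad bc bd cd zero                   (suc (suc zero))       _ = ac
⟨⟩-injective ab ac ad bc bd cd zero                   (suc (suc (suc zero))) _ = ad
⟨⟩-injective ab ac ad bc bd cd (suc zero)             zero                   _ = ab ∘ sym
⟨⟩-injective ab ac ad bc bd cd (suc zero)             (suc (suc zero))       _ = bc
⟨⟩-injective ab ac ad bc bd cd (suc zero)             (suc (suc (suc zero))) _ = bd
⟨⟩-injective ab ac ad bc bd cd (suc (suc zero))       zero                   _ = ac ∘ sym
⟨⟩-injective ab ac ad bc bd cd (suc (suc zero))       (suc zero)             _ = bc ∘ sym
⟨⟩-injective ab ac ad bc bd cd (suc (suc zero))       (suc (suc (suc zero))) _ = cd
⟨⟩-injective ab ac ad bc bd cd (suc (suc (suc zero))) zero                   _ = ad ∘ sym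
⟨⟩-injective ab ac ad bc bd cd (suc (suc (suc zero))) (suc zero)             _ = bd ∘ sym
⟨⟩-injective ab ac ad bc bd cd (suc (suc (suc zero))) (suc (suc zero))       _ = cd ∘ sym
⟨⟩-injective ab ac ad bc bd cd zero                   zero                   i≢i = contradiction refl i≢i
⟨⟩-injective ab ac ad bc bd cd (suc zero)             (suc zero)             i≢i = contradiction refl i≢i
⟨⟩-injective ab ac ad bc bd cd (suc (suc zero))       (suc (suc zero))       i≢i = contradiction refl i≢i
⟨⟩-injective ab ac ad bc bd cd (suc (suc (suc zero))) (suc (suc (suc zero))) i≢i = contradiction refl i≢i

isEmb⇒0<embCount : ∀ {n} (H : Graph 4) (G : Graph n) a b c d → isEmb H G ⟨ a , b , c , d ⟩ ≡ true →
                   0 < embCount H G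
isEmb⇒0<embCount {n} H G a b c d e = begin
  1                                     ≡⟨ cong 𝟙 e ⟨
  emb a b c d                           ≤⟨ term≤∑ (emb a b c) d ⟩
  ∑[ d < n ] emb a b c d                ≤⟨ term≤∑ (λ c → ∑[ d < n ] emb a b c d) c ⟩
  ∑[ c < n ] ∑[ d < n ] emb a b c d     ≤⟨ term≤∑ (λ b → ∑[ c < n ] ∑[ d < n ] emb a b c d) b ⟩
  ∑[ b < n ] ∑[ c < n ] ∑[ d < n ] emb a b c d
    ≤⟨ term≤∑ (λ a → ∑[ b < n ] ∑[ c < n ] ∑[ d < n ] emb a b c d) a ⟩
  ∑[ a < n ] ∑[ b < n ] ∑[ c < n ] ∑[ d < n ] emb a b c d
    ≡⟨ embCount≡∑⁴ H G ⟨
  embCount H G ∎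
  where
  open ≤-Reasoning
  emb : Fin n → Fin n → Fin n → Fin n → ℕ
  emb a b c d = 𝟙 (isEmb H G ⟨ a , b , c , d ⟩)

isEmb-never⇒embCount≡0 : ∀ {n} (H : Graph 4) (G : Graph n) →
                         (∀ a b c d → isEmb H G ⟨ a , b , c , d ⟩ ≢ true) → embCount H G ≡ 0
isEmb-never⇒embCount≡0 H G never = trans (embCount≡∑⁴ H G)
  (∑-zero λ a → ∑-zero λ b → ∑-zero λ c → ∑-zero λ d → 𝟙-false (never a b c d))

-- Adjacency, degrees and common neighbours

module Adjacency {n : ℕ} (G : Graph n) where

  infix 4 _~_
  _~_ : Fin n → Fin n → Set
  x ~ y = adj G x y ≡ true

  ~-sym : ∀ {x y} → x ~ y → y ~ x
  ~-sym {x} {y} x~y = trans (Graph.sym G y x) x~y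

  ~-irrefl : ∀ {x y} → x ~ y → x ≢ y
  ~-irrefl {x} x~x refl = contradiction (trans (sym x~x) (irrefl G x)) λ ()

  deg : Fin n → ℕ
  deg x = ∑[ y < n ] 𝟙 (adj G x y)

  codeg : Fin n → Fin n → ℕ
  codeg x y = ∑[ c < n ] (𝟙 (adj G x c) * 𝟙 (adj G y c))

  ∑-codeg : ∀ y → ∑[ z < n ] codeg y z ≡ ∑[ c < n ] (𝟙 (adj G y c) * deg c)
  ∑-codeg y = begin
    ∑[ z < n ] ∑[ c < n ] (𝟙 (adj G y c) * 𝟙 (adj G z c))
      ≡⟨ ∑-comm (λ z c → 𝟙 (adj G y c) * 𝟙 (adj G z c)) ⟩
    ∑[ c < n ] ∑[ z < n ] (𝟙 (adj G y c) * 𝟙 (adj G z c))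
      ≡⟨ sum-cong-≗ (λ c → sum-cong-≗ λ z → cong (λ b → 𝟙 (adj G y c) * 𝟙 b) (Graph.sym G z c)) ⟩
    ∑[ c < n ] ∑[ z < n ] (𝟙 (adj G y c) * 𝟙 (adj G c z))
      ≡⟨ sum-cong-≗ (λ c → *-distribˡ-sum (𝟙 (adj G y c)) (λ z → 𝟙 (adj G c z))) ⟨
    ∑[ c < n ] (𝟙 (adj G y c) * deg c)                      ∎
    where open ≡-Reasoning

  ∑⟨adj⟩-codeg : ∀ x z → ∑⟨ adj G x ⟩ (λ y → codeg y z) ≡ ∑[ c < n ] (𝟙 (adj G z c) * codeg x c)
  ∑⟨adj⟩-codeg x z = begin
    ∑[ y < n ] (𝟙 (adj G x y) * ∑[ c < n ] (𝟙 (adj G y c) * 𝟙 (adj G z c)))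
      ≡⟨ sum-cong-≗ (λ y → *-distribˡ-sum (𝟙 (adj G x y)) (λ c → 𝟙 (adj G y c) * 𝟙 (adj G z c))) ⟩
    ∑[ y < n ] ∑[ c < n ] (𝟙 (adj G x y) * (𝟙 (adj G y c) * 𝟙 (adj G z c)))
      ≡⟨ ∑-comm (λ y c → 𝟙 (adj G x y) * (𝟙 (adj G y c) * 𝟙 (adj G z c))) ⟩
    ∑[ c < n ] ∑[ y < n ] (𝟙 (adj G x y) * (𝟙 (adj G y c) * 𝟙 (adj G z c)))
      ≡⟨ sum-cong-≗ (λ c → sum-cong-≗ λ y →
           trans (cong (λ b → 𝟙 (adj G x y) * (𝟙 b * 𝟙 (adj G z c))) (Graph.sym G y c))
                 (reorder (𝟙 (adj G x y)) (𝟙 (adj G c y)) (𝟙 (adj G z c)))) ⟩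
    ∑[ c < n ] ∑[ y < n ] (𝟙 (adj G z c) * (𝟙 (adj G x y) * 𝟙 (adj G c y)))
      ≡⟨ sum-cong-≗ (λ c → *-distribˡ-sum (𝟙 (adj G z c)) (λ y → 𝟙 (adj G x y) * 𝟙 (adj G c y))) ⟨
    ∑[ c < n ] (𝟙 (adj G z c) * codeg x c) ∎
    where
    open ≡-Reasoning
    reorder : ∀ a b c → a * (b * c) ≡ c * (a * b)
    reorder = solve-∀

  UniqueCommonNeighbours : Set
  UniqueCommonNeighbours = ∀ {y z c c′} → y ≢ z → y ~ c → z ~ c → y ~ c′ → z ~ c′ → c ≡ c′

  private
    C₄-edges : ∀ {a b c d} → a ~ b → b ~ c → c ~ d → a ~ d →
               ∀ i j → adj C₄ i j ≡ true → ⟨ a , b , c , d ⟩ i ~ ⟨ a , b , c , d ⟩ j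
    C₄-edges ab bc cd ad zero                   (suc zero)             _ = ab
    C₄-edges ab bc cd ad zero                   (suc (suc (suc zero))) _ = ad
    C₄-edges ab bc cd ad (suc zero)             zero                   _ = ~-sym ab
    C₄-edges ab bc cd ad (suc zero)             (suc (suc zero))       _ = bc
    C₄-edges ab bc cd ad (suc (suc zero))       (suc zero)             _ = ~-sym bc
    C₄-edges ab bc cd ad (suc (suc zero))       (suc (suc (suc zero))) _ = cd
    C₄-edges ab bc cd ad (suc (suc (suc zero))) zero                   _ = ~-sym ad
    C₄-edges ab bc cd ad (suc (suc (suc zero))) (suc (suc zero))       _ = ~-sym cd
    C₄-edges ab bc cd ad zero                   zero                   ()
    C₄-edges ab bc cd ad zero                   (suc (suc zero))       ()
    C₄-edges ab bc cd ad (suc zero)             (suc zero)             ()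
    C₄-edges ab bc cd ad (suc zero)             (suc (suc (suc zero))) ()
    C₄-edges ab bc cd ad (suc (suc zero))       zero                   ()
    C₄-edges ab bc cd ad (suc (suc zero))       (suc (suc zero))       ()
    C₄-edges ab bc cd ad (suc (suc (suc zero))) (suc zero)             ()
    C₄-edges ab bc cd ad (suc (suc (suc zero))) (suc (suc (suc zero))) ()

  C₄-free⇒uniqueCommonNeighbours : Free C₄ G → UniqueCommonNeighbours
  C₄-free⇒uniqueCommonNeighbours free {y} {z} {c} {c′} y≢z y~c z~c y~c′ z~c′ with c ≟ c′
  ... | yes c≡c′ = c≡c′
  ... | no  c≢c′ = contradiction free (>⇒≢ (isEmb⇒0<embCount C₄ G y c z c′ cycle))
    where
    cycle : isEmb C₄ G ⟨ y , c , z , c′ ⟩ ≡ true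
    cycle = isEmb-intro C₄ G ⟨ y , c , z , c′ ⟩
      (⟨⟩-injective (~-irrefl y~c) y≢z (~-irrefl y~c′) (~-irrefl (~-sym z~c)) c≢c′ (~-irrefl z~c′))
      (C₄-edges y~c (~-sym z~c) z~c′ y~c′)

  uniqueCommonNeighbours⇒C₄-free : UniqueCommonNeighbours → Free C₄ G
  uniqueCommonNeighbours⇒C₄-free unique = isEmb-never⇒embCount≡0 C₄ G λ a b c d cycle →
    let inj  = isEmb-inj C₄ G ⟨ a , b , c , d ⟩ cycle
        edge = isEmb-adj C₄ G ⟨ a , b , c , d ⟩ cycle
    in inj {suc zero} {suc (suc (suc zero))} (λ ())
         (unique (inj {zero} {suc (suc zero)} (λ ()))
           (edge {zero} {suc zero} refl) (edge {suc (suc zero)} {suc zero} refl)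
           (edge {zero} {suc (suc (suc zero))} refl) (edge {suc (suc zero)} {suc (suc (suc zero))} refl))

-- Paws in C₄-free graphs

module Paws {n : ℕ} (G : Graph n) where

  open Adjacency G

  -- T₁ has triangle 0 1 2 and pendant 3 at 2, so this counts the paws with a degree-2
  -- triangle vertex at y and the pendant vertex at z.
  paws : Fin n → Fin n → ℕ
  paws y z = ∑[ a < n ] ∑[ c < n ] 𝟙 (isEmb T₁ G ⟨ a , y , c , z ⟩)

  embCount≡∑paws : embCount T₁ G ≡ ∑[ y < n ] ∑[ z < n ] paws y z
  embCount≡∑paws = begin
    embCount T₁ G
      ≡⟨ embCount≡∑⁴ T₁ G ⟩
    ∑[ a < n ] ∑[ y < n ] ∑[ c < n ] ∑[ z < n ] emb a y c z
      ≡⟨ ∑-comm (λ a y → ∑[ c < n ] ∑[ z < n ] emb a y c z) ⟩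
    ∑[ y < n ] ∑[ a < n ] ∑[ c < n ] ∑[ z < n ] emb a y c z
      ≡⟨ sum-cong-≗ (λ y → sum-cong-≗ λ a → ∑-comm (emb a y)) ⟩
    ∑[ y < n ] ∑[ a < n ] ∑[ z < n ] ∑[ c < n ] emb a y c z
      ≡⟨ sum-cong-≗ (λ y → ∑-comm (λ a z → ∑[ c < n ] emb a y c z)) ⟩
    ∑[ y < n ] ∑[ z < n ] ∑[ a < n ] ∑[ c < n ] emb a y c z ∎
    where
    open ≡-Reasoning
    emb : Fin n → Fin n → Fin n → Fin n → ℕ
    emb a y c z = 𝟙 (isEmb T₁ G ⟨ a , y , c , z ⟩)

  record Paw (a y c z : Fin n) : Set where
    field
      a~y : a ~ y
      y~c : y ~ c
      a~c : a ~ c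
      c~z : c ~ z
      z≢a : z ≢ a
      z≢y : z ≢ y

  isEmb⇒Paw : ∀ a y c z → isEmb T₁ G ⟨ a , y , c , z ⟩ ≡ true → Paw a y c z
  isEmb⇒Paw a y c z e = record
    { a~y = edge zero (suc zero) refl
    ; y~c = edge (suc zero) (suc (suc zero)) refl
    ; a~c = edge zero (suc (suc zero)) refl
    ; c~z = edge (suc (suc zero)) (suc (suc (suc zero))) refl
    ; z≢a = isEmb-inj T₁ G ⟨ a , y , c , z ⟩ e {suc (suc (suc zero))} {zero} (λ ())
    ; z≢y = isEmb-inj T₁ G ⟨ a , y , c , z ⟩ e {suc (suc (suc zero))} {suc zero} (λ ())
    }
    where
    edge : ∀ i j → adj T₁ i j ≡ true → ⟨ a , y , c , z ⟩ i ~ ⟨ a , y , c , z ⟩ j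
    edge i j = isEmb-adj T₁ G ⟨ a , y , c , z ⟩ e {i} {j}

  private
    T₁-edges : ∀ {a y c z} → a ~ y → y ~ c → a ~ c → c ~ z →
               ∀ i j → adj T₁ i j ≡ true → ⟨ a , y , c , z ⟩ i ~ ⟨ a , y , c , z ⟩ j
    T₁-edges ay yc ac cz zero                   (suc zero)             _ = ay
    T₁-edges ay yc ac cz zero                   (suc (suc zero))       _ = ac
    T₁-edges ay yc ac cz (suc zero)             zero                   _ = ~-sym ay
    T₁-edges ay yc ac cz (suc zero)             (suc (suc zero))       _ = yc
    T₁-edges ay yc ac cz (suc (suc zero))       zero                   _ = ~-sym ac
    T₁-edges ay yc ac cz (suc (suc zero))       (suc zero)             _ = ~-sym yc
    T₁-edges ay yc ac cz (suc (suc zero))       (suc (suc (suc zero))) _ = cz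
    T₁-edges ay yc ac cz (suc (suc (suc zero))) (suc (suc zero))       _ = ~-sym cz
    T₁-edges ay yc ac cz zero                   zero                   ()
    T₁-edges ay yc ac cz zero                   (suc (suc (suc zero))) ()
    T₁-edges ay yc ac cz (suc zero)             (suc zero)             ()
    T₁-edges ay yc ac cz (suc zero)             (suc (suc (suc zero))) ()
    T₁-edges ay yc ac cz (suc (suc zero))       (suc (suc zero))       ()
    T₁-edges ay yc ac cz (suc (suc (suc zero))) zero                   ()
    T₁-edges ay yc ac cz (suc (suc (suc zero))) (suc zero)             ()
    T₁-edges ay yc ac cz (suc (suc (suc zero))) (suc (suc (suc zero))) ()

  Paw⇒isEmb : ∀ a y c z → Paw a y c z → isEmb T₁ G ⟨ a , y , c , z ⟩ ≡ true
  Paw⇒isEmb a y c z p = isEmb-intro T₁ G ⟨ a , y , c , z ⟩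
    (⟨⟩-injective (~-irrefl a~y) (~-irrefl a~c) (z≢a ∘ sym) (~-irrefl y~c) (z≢y ∘ sym) (~-irrefl c~z))
    (T₁-edges a~y y~c a~c c~z)
    where open Paw p

  paws-witness : ∀ {y z} → 0 < paws y z → ∃₂ λ a c → Paw a y c z
  paws-witness {y} {z} pos with ∑-pos _ pos
  ... | a , pos′ with ∑-pos _ pos′
  ...   | c , pos″ = a , c , isEmb⇒Paw a y c z (𝟙-pos pos″)

  paws≡0 : ∀ {y z} → (∀ a c → ¬ Paw a y c z) → paws y z ≡ 0
  paws≡0 {y} {z} no-paw = ∑-zero λ a → ∑-zero λ c → 𝟙-false (no-paw a c ∘ isEmb⇒Paw a y c z)

  paws-diag : ∀ y → paws y y ≡ 0
  paws-diag y = paws≡0 λ _ _ p → Paw.z≢y p refl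

module C₄-free {n : ℕ} (G : Graph n) (free : Free C₄ G) where

  open Adjacency G
  open Paws G

  unique : UniqueCommonNeighbours
  unique = C₄-free⇒uniqueCommonNeighbours free

  codeg≤1 : ∀ {y z} → y ≢ z → codeg y z ≤ 1
  codeg≤1 {y} {z} y≢z = ∑≤1 _ (λ c → 𝟙*𝟙≤1 (adj G y c) (adj G z c)) λ c c′ pos pos′ →
    let y~c , z~c = 𝟙*𝟙-pos _ _ pos ; y~c′ , z~c′ = 𝟙*𝟙-pos _ _ pos′ in unique y≢z y~c z~c y~c′ z~c′

  private
    apex-unique : ∀ {a a′ y c c′ z} → Paw a y c z → Paw a′ y c′ z → c ≡ c′
    apex-unique p p′ = unique (Paw.z≢y p ∘ sym) (Paw.y~c p) (~-sym (Paw.c~z p)) (Paw.y~c p′) (~-sym (Paw.c~z p′))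

    third-vertex-unique : ∀ {a a′ y c z z′} → Paw a y c z → Paw a′ y c z′ → a ≡ a′
    third-vertex-unique p p′ = unique (~-irrefl (Paw.y~c p)) (~-sym (Paw.a~y p)) (~-sym (Paw.a~c p))
                                      (~-sym (Paw.a~y p′)) (~-sym (Paw.a~c p′))

  paws≤1 : ∀ y z → paws y z ≤ 1
  paws≤1 y z = ∑≤1 row (λ a → ∑≤1 (emb a) (λ c → 𝟙≤1 _) λ c c′ pos pos′ →
                                  apex-unique (isEmb⇒Paw a y c z (𝟙-pos pos)) (isEmb⇒Paw a y c′ z (𝟙-pos pos′)))
    λ a a′ pos pos′ → let c , posc = ∑-pos (emb a) pos ; c′ , posc′ = ∑-pos (emb a′) pos′
                          p = isEmb⇒Paw a y c z (𝟙-pos posc) ; p′ = isEmb⇒Paw a′ y c′ z (𝟙-pos posc′)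
                      in third-vertex-unique p (subst (λ c → Paw a′ y c z) (sym (apex-unique p p′)) p′)
    where
    emb : Fin n → Fin n → ℕ
    emb a c = 𝟙 (isEmb T₁ G ⟨ a , y , c , z ⟩)
    row : Fin n → ℕ
    row a = ∑[ c < n ] emb a c

  paws-adj : ∀ {y z} → y ~ z → paws y z ≡ 0
  paws-adj y~z = paws≡0 λ a c p → Paw.z≢a p (sym
    (unique (~-irrefl (Paw.y~c p)) (~-sym (Paw.a~y p)) (~-sym (Paw.a~c p)) y~z (Paw.c~z p)))

  paws≤codeg : ∀ y z → paws y z ≤ codeg y z
  paws≤codeg y z with 0 <? paws y z
  ... | no  paws≯0 = ≤-trans (≮⇒≥ paws≯0) z≤n
  ... | yes paws>0 with paws-witness paws>0
  ...   | a , c , p = ≤-trans (paws≤1 y z) (≤-trans (≤-reflexive (sym common)) (term≤∑ _ c))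
    where
    common : 𝟙 (adj G y c) * 𝟙 (adj G z c) ≡ 1
    common rewrite Paw.y~c p | ~-sym (Paw.c~z p) = refl

  paws+δ+adj≤1 : ∀ y z → paws y z + 𝟙 ⌊ z ≟ y ⌋ + 𝟙 (adj G y z) ≤ 1
  paws+δ+adj≤1 y z = by-cases y z (z ≟ y) (adj G y z) refl
    where
    by-cases : ∀ y z (z≟y : Dec (z ≡ y)) b → adj G y z ≡ b → paws y z + 𝟙 ⌊ z≟y ⌋ + 𝟙 b ≤ 1
    by-cases y .y (yes refl) b y~y =
      subst₂ (λ k b → k + 1 + 𝟙 b ≤ 1) (sym (paws-diag y)) (trans (sym (irrefl G y)) y~y) ≤-refl
    by-cases y z (no _) true  y~z = subst (λ k → k + 0 + 1 ≤ 1) (sym (paws-adj y~z)) ≤-refl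
    by-cases y z (no _) false _   = subst (_≤ 1) (sym (trans (+-identityʳ _) (+-identityʳ _))) (paws≤1 y z)

  ∑paws≤n*[m*m] : ∀ m → (∀ x → deg x ≤ m) → ∑[ y < n ] ∑[ z < n ] paws y z ≤ n * (m * m)
  ∑paws≤n*[m*m] m deg≤m = begin
    ∑[ y < n ] ∑[ z < n ] paws y z
      ≤⟨ ∑-mono-≤ (λ y → ∑-mono-≤ (paws≤codeg y)) ⟩
    ∑[ y < n ] ∑[ z < n ] codeg y z
      ≡⟨ sum-cong-≗ ∑-codeg ⟩
    ∑[ y < n ] ∑[ c < n ] (𝟙 (adj G y c) * deg c)
      ≤⟨ ∑-mono-≤ (λ y → ∑-mono-≤ λ c → *-monoʳ-≤ (𝟙 (adj G y c)) (deg≤m c)) ⟩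
    ∑[ y < n ] ∑[ c < n ] (𝟙 (adj G y c) * m)
      ≡⟨ sum-cong-≗ (λ y → *-distribʳ-sum m (λ c → 𝟙 (adj G y c))) ⟨
    ∑[ y < n ] (deg y * m)
      ≤⟨ ∑-mono-≤ (λ y → *-monoˡ-≤ m (deg≤m y)) ⟩
    ∑[ y < n ] (m * m)
      ≡⟨ ∑-const n (m * m) ⟩
    n * (m * m) ∎
    where open ≤-Reasoning

-- The upper bound

-- The number of embeddings of T₁ into F n: the triangle uses one of the 2⌊(n−1)/2⌋ ordered matching
-- edges together with the hub, and the pendant is one of the n − 3 remaining vertices.
pawCount : ℕ → ℕ
pawCount n = 2 * ((n ∸ 1) / 2) * (n ∸ 3)

m∸1≤2*[m/2] : ∀ m → m ∸ 1 ≤ 2 * (m / 2)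
m∸1≤2*[m/2] m = begin
  m ∸ 1                        ≡⟨ cong (_∸ 1) (m≡m%n+[m/n]*n m 2) ⟩
  m % 2 + m / 2 * 2 ∸ 1        ≤⟨ ∸-monoˡ-≤ 1 (+-monoˡ-≤ (m / 2 * 2) (≤-pred (m%n<n m 2))) ⟩
  1 + m / 2 * 2 ∸ 1            ≡⟨ *-comm (m / 2) 2 ⟩
  2 * (m / 2)                  ∎
  where open ≤-Reasoning

2*k≤m⇒2*k≤2*[m/2] : ∀ {k m} → 2 * k ≤ m → 2 * k ≤ 2 * (m / 2)
2*k≤m⇒2*k≤2*[m/2] {k} {m} 2k≤m = *-monoʳ-≤ 2 (begin
  k                ≡⟨ m*n/n≡m k 2 ⟨
  k * 2 / 2        ≡⟨ cong (_/ 2) (*-comm k 2) ⟩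
  2 * k / 2        ≤⟨ /-monoˡ-≤ 2 2k≤m ⟩
  m / 2            ∎)
  where open ≤-Reasoning

[n∸2]*[n∸3]≤pawCount : ∀ n → (n ∸ 2) * (n ∸ 3) ≤ pawCount n
[n∸2]*[n∸3]≤pawCount n =
  *-monoˡ-≤ (n ∸ 3) (subst (_≤ 2 * ((n ∸ 1) / 2)) (∸-+-assoc n 1 1) (m∸1≤2*[m/2] (n ∸ 1)))

n*[m*m]≤pawCount : ∀ m n → 5 + m * m ≤ n → n * (m * m) ≤ pawCount n
n*[m*m]≤pawCount m n 5+m*m≤n with m≤n⇒∃[o]m+o≡n 5+m*m≤n
... | d , refl = ≤-trans (≤-trans (m≤m+n _ _) (≤-reflexive (expand m d))) ([n∸2]*[n∸3]≤pawCount (5 + m * m + d))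
  where
  expand : ∀ m d → (5 + (m * m + d)) * (m * m) + (6 + m * m * d + 5 * d + d * d)
                   ≡ (3 + (m * m + d)) * (2 + (m * m + d))
  expand = solve-∀

blocks≤pawCount : ∀ Δ r M B → 8 ≤ Δ → M ≤ Δ → (∃ λ k → M ≡ 2 * k) →
                  B ≤ r * Δ → (r ≤ 1 → B ≡ 0) →
                  r + (Δ ∸ 2) * M + (r + B + r * r) ≤ pawCount (1 + Δ + r)
blocks≤pawCount Δ zero M B _ M≤Δ (k , refl) _ B≡0 rewrite B≡0 z≤n | +-identityʳ Δ = begin
  (Δ ∸ 2) * (2 * k) + 0        ≡⟨ +-identityʳ ((Δ ∸ 2) * (2 * k)) ⟩
  (Δ ∸ 2) * (2 * k)            ≤⟨ *-monoʳ-≤ (Δ ∸ 2) (2*k≤m⇒2*k≤2*[m/2] {k} M≤Δ) ⟩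
  (Δ ∸ 2) * (2 * (Δ / 2))      ≡⟨ *-comm (Δ ∸ 2) (2 * (Δ / 2)) ⟩
  2 * (Δ / 2) * (Δ ∸ 2)        ∎
  where open ≤-Reasoning
blocks≤pawCount Δ (suc zero) M B 8≤Δ M≤Δ _ _ B≡0 with m≤n⇒∃[o]m+o≡n 8≤Δ
... | d , refl rewrite B≡0 ≤-refl = begin
  1 + (6 + d) * M + 2                 ≤⟨ +-monoˡ-≤ 2 (+-monoʳ-≤ 1 (*-monoʳ-≤ (6 + d) M≤Δ)) ⟩
  1 + (6 + d) * (8 + d) + 2           ≤⟨ m≤m+n _ (5 + d) ⟩
  1 + (6 + d) * (8 + d) + 2 + (5 + d) ≡⟨ expand d ⟩
  (7 + (d + 1)) * (6 + (d + 1))       ≤⟨ [n∸2]*[n∸3]≤pawCount (1 + (8 + d) + 1) ⟩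
  pawCount (1 + (8 + d) + 1)          ∎
  where
  open ≤-Reasoning
  expand : ∀ d → 1 + (6 + d) * (8 + d) + 2 + (5 + d) ≡ (7 + (d + 1)) * (6 + (d + 1))
  expand = solve-∀
blocks≤pawCount Δ (suc (suc s)) M B 8≤Δ M≤Δ _ B≤rΔ _ with m≤n⇒∃[o]m+o≡n 8≤Δ
... | d , refl = begin
  r + (6 + d) * M + (r + B + r * r)
    ≤⟨ +-mono-≤ (+-monoʳ-≤ r (*-monoʳ-≤ (6 + d) M≤Δ)) (+-monoˡ-≤ (r * r) (+-monoʳ-≤ r B≤rΔ)) ⟩
  r + (6 + d) * (8 + d) + (r + r * (8 + d) + r * r)
    ≤⟨ m≤m+n _ (d + 3 * s + d * s) ⟩
  r + (6 + d) * (8 + d) + (r + r * (8 + d) + r * r) + (d + 3 * s + d * s)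
    ≡⟨ expand d s ⟩
  (7 + (d + r)) * (6 + (d + r))       ≤⟨ [n∸2]*[n∸3]≤pawCount (1 + (8 + d) + r) ⟩
  pawCount (1 + (8 + d) + r)          ∎
  where
  open ≤-Reasoning
  r : ℕ
  r = 2 + s
  expand : ∀ d s → 2 + s + (6 + d) * (8 + d) + (2 + s + (2 + s) * (8 + d) + (2 + s) * (2 + s)) + (d + 3 * s + d * s)
                   ≡ (7 + (d + (2 + s))) * (6 + (d + (2 + s)))
  expand = solve-∀

module AroundVertex {n : ℕ} (G : Graph n) (free : Free C₄ G) (v : Fin n) where

  open Adjacency G
  open Paws G
  open C₄-free G free

  near : Fin n → Bool
  near = adj G v

  far : Fin n → Bool
  far x = not ⌊ x ≟ v ⌋ ∧ not (adj G v x)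

  Δ r : ℕ
  Δ = deg v
  r = ∑[ x < n ] 𝟙 (far x)

  data Position (x : Fin n) : Set where
    centre  : x ≡ v → Position x
    is-near : v ~ x → Position x
    is-far  : far x ≡ true → Position x

  far-intro : ∀ {x} → x ≢ v → adj G v x ≡ false → far x ≡ true
  far-intro {x} x≢v v≁x with x ≟ v
  ... | yes x≡v = contradiction x≡v x≢v
  ... | no  _   = cong not v≁x

  far-elim : ∀ {x} → far x ≡ true → x ≢ v × adj G v x ≡ false
  far-elim {x} x-far with x ≟ v | adj G v x | x-far
  ... | no x≢v | false | _ = x≢v , refl

  position : ∀ x → Position x
  position x with x ≟ v | adj G v x in v~x
  ... | yes x≡v | _     = centre x≡v
  ... | no  _   | true  = is-near v~x
  ... | no  x≢v | false = is-far (far-intro x≢v v~x)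

  partition : ∀ x → 𝟙 ⌊ x ≟ v ⌋ + 𝟙 (near x) + 𝟙 (far x) ≡ 1
  partition x with x ≟ v | adj G v x in v~x
  ... | yes refl | true  = contradiction (trans (sym v~x) (irrefl G v)) λ ()
  ... | yes refl | false = refl
  ... | no  _    | true  = refl
  ... | no  _    | false = refl

  ∑-split : ∀ f → sum f ≡ f v + ∑⟨ near ⟩ f + ∑⟨ far ⟩ f
  ∑-split f = begin
    sum f
      ≡⟨ sum-cong-≗ (λ x → trans (sym (*-identityˡ (f x))) (cong (_* f x) (sym (partition x)))) ⟩
    ∑[ x < n ] ((𝟙 ⌊ x ≟ v ⌋ + 𝟙 (near x) + 𝟙 (far x)) * f x)
      ≡⟨ sum-cong-≗ (λ x → distrib (𝟙 ⌊ x ≟ v ⌋) (𝟙 (near x)) (𝟙 (far x)) (f x)) ⟩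
    ∑[ x < n ] (𝟙 ⌊ x ≟ v ⌋ * f x + 𝟙 (near x) * f x + 𝟙 (far x) * f x)
      ≡⟨ ∑-distrib-+ (λ x → 𝟙 ⌊ x ≟ v ⌋ * f x + 𝟙 (near x) * f x) (λ x → 𝟙 (far x) * f x) ⟩
    ∑[ x < n ] (𝟙 ⌊ x ≟ v ⌋ * f x + 𝟙 (near x) * f x) + ∑⟨ far ⟩ f
      ≡⟨ cong (_+ ∑⟨ far ⟩ f) (∑-distrib-+ (λ x → 𝟙 ⌊ x ≟ v ⌋ * f x) (λ x → 𝟙 (near x) * f x)) ⟩
    ∑[ x < n ] (𝟙 ⌊ x ≟ v ⌋ * f x) + ∑⟨ near ⟩ f + ∑⟨ far ⟩ f
      ≡⟨ cong (λ t → t + ∑⟨ near ⟩ f + ∑⟨ far ⟩ f) (∑-δ v f) ⟩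
    f v + ∑⟨ near ⟩ f + ∑⟨ far ⟩ f
      ∎
    where
    open ≡-Reasoning
    distrib : ∀ a b c x → (a + b + c) * x ≡ a * x + b * x + c * x
    distrib = solve-∀

  ∑⟨near⟩1≡Δ : ∑⟨ near ⟩ (λ _ → 1) ≡ Δ
  ∑⟨near⟩1≡Δ = trans (∑⟨⟩-const near 1) (*-identityʳ Δ)

  ∑⟨far⟩1≡r : ∑⟨ far ⟩ (λ _ → 1) ≡ r
  ∑⟨far⟩1≡r = trans (∑⟨⟩-const far 1) (*-identityʳ r)

  ∑⟨near⟩≤Δ : ∀ {f} → (∀ x → f x ≤ 1) → ∑⟨ near ⟩ f ≤ Δ
  ∑⟨near⟩≤Δ f≤1 = ≤-trans (∑⟨⟩-mono-≤ near (λ x _ → f≤1 x)) (≤-reflexive ∑⟨near⟩1≡Δ)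

  n≡1+Δ+r : n ≡ 1 + Δ + r
  n≡1+Δ+r = begin
    n                                             ≡⟨ trans (sym (*-identityʳ n)) (sym (∑-const n 1)) ⟩
    ∑[ x < n ] 1                                  ≡⟨ ∑-split (λ _ → 1) ⟩
    1 + ∑⟨ near ⟩ (λ _ → 1) + ∑⟨ far ⟩ (λ _ → 1)  ≡⟨ cong₂ (λ a b → 1 + a + b) ∑⟨near⟩1≡Δ ∑⟨far⟩1≡r ⟩
    1 + Δ + r                                     ∎
    where open ≡-Reasoning

  row : Fin n → ℕ
  row y = ∑[ z < n ] paws y z

  farDeg : Fin n → ℕ
  farDeg y = ∑⟨ far ⟩ (𝟙 ∘ adj G y)

  ∑farDeg nearEdges farToNear : ℕ
  ∑farDeg   = ∑⟨ far ⟩ farDeg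
  nearEdges = ∑⟨ near ⟩ (codeg v)
  farToNear = ∑⟨ far ⟩ (λ y → ∑⟨ near ⟩ (paws y))

  row-v≤r : row v ≤ r
  row-v≤r = begin
    row v                                              ≡⟨ ∑-split (paws v) ⟩
    paws v v + ∑⟨ near ⟩ (paws v) + ∑⟨ far ⟩ (paws v)  ≡⟨ cong₂ (λ a b → a + b + ∑⟨ far ⟩ (paws v))
                                                                (paws-diag v) (∑⟨⟩-zero near λ z → paws-adj) ⟩
    ∑⟨ far ⟩ (paws v)                                  ≤⟨ ∑⟨⟩-mono-≤ far (λ z _ → paws≤1 v z) ⟩
    ∑⟨ far ⟩ (λ _ → 1)                                 ≡⟨ ∑⟨far⟩1≡r ⟩
    r                                                  ∎
    where open ≤-Reasoning

  -- The apex of a paw from y to a neighbour z of v is a common neighbour of y and z, hence v itself,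
  -- so the paw's third vertex is a neighbour of y inside N(v).
  near-to-near≤ : ∀ {y} → v ~ y → ∑⟨ near ⟩ (paws y) ≤ (Δ ∸ 2) * codeg v y
  near-to-near≤ {y} v~y with 0 <? codeg v y
  ... | no codeg≯0 = ≤-trans (≤-reflexive (∑⟨⟩-zero near λ z v~z → paws≡0 λ a c p →
                                codeg≯0 (codeg-pos (subst (a ~_) (apex-v p v~z) (Paw.a~c p)) (Paw.a~y p))))
                             z≤n
    where
    apex-v : ∀ {a c z} → Paw a y c z → v ~ z → c ≡ v
    apex-v p v~z = unique (Paw.z≢y p ∘ sym) (Paw.y~c p) (~-sym (Paw.c~z p)) (~-sym v~y) (~-sym v~z)
    codeg-pos : ∀ {a} → a ~ v → a ~ y → 0 < codeg v y
    codeg-pos {a} a~v a~y = ≤-trans (≤-reflexive (sym (cong₂ (λ b c → 𝟙 b * 𝟙 c) (~-sym a~v) (~-sym a~y))))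
                                    (term≤∑ (λ c → 𝟙 (adj G v c) * 𝟙 (adj G y c)) a)
  ... | yes codeg>0 with ∑-pos (λ c → 𝟙 (adj G v c) * 𝟙 (adj G y c)) codeg>0
  ...   | w , pos = begin
    ∑⟨ near ⟩ (paws y)   ≤⟨ m+n≤o⇒m≤o∸n _ two-missing ⟩
    Δ ∸ 2                ≤⟨ m≤m*n (Δ ∸ 2) (codeg v y) {{>-nonZero codeg>0}} ⟩
    (Δ ∸ 2) * codeg v y  ∎
    where
    open ≤-Reasoning
    v~w : v ~ w
    v~w = proj₁ (𝟙*𝟙-pos (adj G v w) (adj G y w) pos)
    y~w : y ~ w
    y~w = proj₂ (𝟙*𝟙-pos (adj G v w) (adj G y w) pos)
    vanishing : ∀ {z} → v ~ z → paws y z ≡ 0 → 𝟙 (near z) * paws y z < 𝟙 (near z)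
    vanishing v~z paws≡0 rewrite v~z | paws≡0 = ≤-refl
    two-missing : ∑⟨ near ⟩ (paws y) + 2 ≤ Δ
    two-missing = ∑+2≤∑ (λ z → ≤-trans (*-monoʳ-≤ (𝟙 (near z)) (paws≤1 y z)) (≤-reflexive (*-identityʳ _)))
                        (~-irrefl y~w) (vanishing v~y (paws-diag y)) (vanishing v~w (paws-adj y~w))

  row-near≤ : ∀ {y} → v ~ y → row y ≤ (Δ ∸ 2) * codeg v y + ∑⟨ far ⟩ (paws y)
  row-near≤ {y} v~y = begin
    row y
      ≡⟨ ∑-split (paws y) ⟩
    paws y v + ∑⟨ near ⟩ (paws y) + ∑⟨ far ⟩ (paws y)
      ≡⟨ cong (λ k → k + ∑⟨ near ⟩ (paws y) + ∑⟨ far ⟩ (paws y)) (paws-adj (~-sym v~y)) ⟩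
    ∑⟨ near ⟩ (paws y) + ∑⟨ far ⟩ (paws y)
      ≤⟨ +-monoˡ-≤ (∑⟨ far ⟩ (paws y)) (near-to-near≤ v~y) ⟩
    (Δ ∸ 2) * codeg v y + ∑⟨ far ⟩ (paws y) ∎
    where open ≤-Reasoning

  -- Each paw from N(v) to z has its apex among the neighbours c of z, and such a c ≠ v has at most
  -- one neighbour in N(v); the neighbours of z themselves are at most one vertex of N(v) and farDeg z.
  near-to-far≤ : ∀ {z} → far z ≡ true → ∑⟨ near ⟩ (λ y → paws y z) ≤ 1 + farDeg z
  near-to-far≤ {z} z-far = begin
    ∑⟨ near ⟩ (λ y → paws y z)               ≤⟨ ∑⟨⟩-mono-≤ near (λ y _ → paws≤codeg y z) ⟩
    ∑⟨ near ⟩ (λ y → codeg y z)              ≡⟨ ∑⟨adj⟩-codeg v z ⟩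
    ∑[ c < n ] (𝟙 (adj G z c) * codeg v c)   ≤⟨ ∑-mono-≤ at-most-one ⟩
    deg z                                    ≡⟨ ∑-split (𝟙 ∘ adj G z) ⟩
    𝟙 (adj G z v) + codeg v z + farDeg z     ≡⟨ cong (λ b → 𝟙 b + codeg v z + farDeg z) z≁v ⟩
    codeg v z + farDeg z                     ≤⟨ +-monoˡ-≤ (farDeg z) (codeg≤1 (proj₁ (far-elim z-far) ∘ sym)) ⟩
    1 + farDeg z                             ∎
    where
    open ≤-Reasoning
    z≁v : adj G z v ≡ false
    z≁v = trans (Graph.sym G z v) (proj₂ (far-elim z-far))
    v≢c : ∀ {c} → z ~ c → v ≢ c
    v≢c z~v refl = contradiction (trans (sym z~v) z≁v) λ ()
    at-most-one : ∀ c → 𝟙 (adj G z c) * codeg v c ≤ 𝟙 (adj G z c)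
    at-most-one c with adj G z c in z~c
    ... | false = z≤n
    ... | true  = ≤-trans (≤-reflexive (+-identityʳ _)) (codeg≤1 (v≢c z~c))

  far-to-far≤ : ∀ {y} → far y ≡ true → ∑⟨ far ⟩ (paws y) + 1 + farDeg y ≤ r
  far-to-far≤ {y} y-far = begin
    ∑⟨ far ⟩ (paws y) + 1 + farDeg y
      ≡⟨ cong (λ k → ∑⟨ far ⟩ (paws y) + k + farDeg y) (∑⟨⟩-δ far y-far) ⟨
    ∑⟨ far ⟩ (paws y) + ∑⟨ far ⟩ (λ z → 𝟙 ⌊ z ≟ y ⌋) + farDeg y
      ≡⟨ cong (_+ farDeg y) (∑⟨⟩-+ far (paws y) (λ z → 𝟙 ⌊ z ≟ y ⌋)) ⟨
    ∑⟨ far ⟩ (λ z → paws y z + 𝟙 ⌊ z ≟ y ⌋) + farDeg y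
      ≡⟨ ∑⟨⟩-+ far (λ z → paws y z + 𝟙 ⌊ z ≟ y ⌋) (𝟙 ∘ adj G y) ⟨
    ∑⟨ far ⟩ (λ z → paws y z + 𝟙 ⌊ z ≟ y ⌋ + 𝟙 (adj G y z))
      ≤⟨ ∑⟨⟩-mono-≤ far (λ z _ → paws+δ+adj≤1 y z) ⟩
    ∑⟨ far ⟩ (λ _ → 1)
      ≡⟨ ∑⟨far⟩1≡r ⟩
    r ∎
    where open ≤-Reasoning

  row-far≤ : ∀ {y} → far y ≡ true → row y + 1 + farDeg y ≤ 1 + ∑⟨ near ⟩ (paws y) + r
  row-far≤ {y} y-far = begin
    row y + 1 + farDeg y
      ≡⟨ cong (λ k → k + 1 + farDeg y) (∑-split (paws y)) ⟩
    paws y v + ∑⟨ near ⟩ (paws y) + ∑⟨ far ⟩ (paws y) + 1 + farDeg y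
      ≡⟨ regroup (paws y v) (∑⟨ near ⟩ (paws y)) (∑⟨ far ⟩ (paws y)) (farDeg y) ⟩
    paws y v + ∑⟨ near ⟩ (paws y) + (∑⟨ far ⟩ (paws y) + 1 + farDeg y)
      ≤⟨ +-mono-≤ (+-monoˡ-≤ (∑⟨ near ⟩ (paws y)) (paws≤1 y v)) (far-to-far≤ y-far) ⟩
    1 + ∑⟨ near ⟩ (paws y) + r ∎
    where
    open ≤-Reasoning
    regroup : ∀ a b c d → a + b + c + 1 + d ≡ a + b + (c + 1 + d)
    regroup = solve-∀

  ∑⟨near⟩rows≤ : ∑⟨ near ⟩ row ≤ (Δ ∸ 2) * nearEdges + (r + ∑farDeg)
  ∑⟨near⟩rows≤ = begin
    ∑⟨ near ⟩ row
      ≤⟨ ∑⟨⟩-mono-≤ near (λ y v~y → row-near≤ v~y) ⟩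
    ∑⟨ near ⟩ (λ y → (Δ ∸ 2) * codeg v y + ∑⟨ far ⟩ (paws y))
      ≡⟨ ∑⟨⟩-+ near (λ y → (Δ ∸ 2) * codeg v y) (λ y → ∑⟨ far ⟩ (paws y)) ⟩
    ∑⟨ near ⟩ (λ y → (Δ ∸ 2) * codeg v y) + ∑⟨ near ⟩ (λ y → ∑⟨ far ⟩ (paws y))
      ≡⟨ cong₂ _+_ (∑⟨⟩-*ˡ near (Δ ∸ 2) (codeg v)) (∑⟨⟩-comm near far paws) ⟩
    (Δ ∸ 2) * nearEdges + ∑⟨ far ⟩ (λ z → ∑⟨ near ⟩ (λ y → paws y z))
      ≤⟨ +-monoʳ-≤ ((Δ ∸ 2) * nearEdges) (∑⟨⟩-mono-≤ far (λ z z-far → near-to-far≤ z-far)) ⟩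
    (Δ ∸ 2) * nearEdges + ∑⟨ far ⟩ (λ z → 1 + farDeg z)
      ≡⟨ cong ((Δ ∸ 2) * nearEdges +_)
              (trans (∑⟨⟩-+ far (λ _ → 1) farDeg) (cong (_+ ∑farDeg) ∑⟨far⟩1≡r)) ⟩
    (Δ ∸ 2) * nearEdges + (r + ∑farDeg) ∎
    where open ≤-Reasoning

  ∑⟨far⟩rows≤ : ∑⟨ far ⟩ row + (r + ∑farDeg) ≤ r + farToNear + r * r
  ∑⟨far⟩rows≤ = begin
    ∑⟨ far ⟩ row + (r + ∑farDeg)
      ≡⟨ cong (λ k → ∑⟨ far ⟩ row + (k + ∑farDeg)) ∑⟨far⟩1≡r ⟨
    ∑⟨ far ⟩ row + (∑⟨ far ⟩ (λ _ → 1) + ∑farDeg)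
      ≡⟨ +-assoc (∑⟨ far ⟩ row) _ ∑farDeg ⟨
    ∑⟨ far ⟩ row + ∑⟨ far ⟩ (λ _ → 1) + ∑farDeg
      ≡⟨ cong (_+ ∑farDeg) (∑⟨⟩-+ far row (λ _ → 1)) ⟨
    ∑⟨ far ⟩ (λ y → row y + 1) + ∑farDeg
      ≡⟨ ∑⟨⟩-+ far (λ y → row y + 1) farDeg ⟨
    ∑⟨ far ⟩ (λ y → row y + 1 + farDeg y)
      ≤⟨ ∑⟨⟩-mono-≤ far (λ y y-far → row-far≤ y-far) ⟩
    ∑⟨ far ⟩ (λ y → 1 + ∑⟨ near ⟩ (paws y) + r)
      ≡⟨ ∑⟨⟩-+ far (λ y → 1 + ∑⟨ near ⟩ (paws y)) (λ _ → r) ⟩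
    ∑⟨ far ⟩ (λ y → 1 + ∑⟨ near ⟩ (paws y)) + ∑⟨ far ⟩ (λ _ → r)
      ≡⟨ cong₂ _+_ (trans (∑⟨⟩-+ far (λ _ → 1) (λ y → ∑⟨ near ⟩ (paws y)))
                          (cong (_+ farToNear) ∑⟨far⟩1≡r))
                   (∑⟨⟩-const far r) ⟩
    r + farToNear + r * r ∎
    where open ≤-Reasoning

  ∑rows≤ : ∑[ y < n ] row y ≤ r + (Δ ∸ 2) * nearEdges + (r + farToNear + r * r)
  ∑rows≤ = +-cancelʳ-≤ (r + ∑farDeg) _ _ (begin
    ∑[ y < n ] row y + (r + ∑farDeg)
      ≡⟨ cong (_+ (r + ∑farDeg)) (∑-split row) ⟩
    row v + ∑⟨ near ⟩ row + ∑⟨ far ⟩ row + (r + ∑farDeg)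
      ≡⟨ +-assoc (row v + ∑⟨ near ⟩ row) _ _ ⟩
    row v + ∑⟨ near ⟩ row + (∑⟨ far ⟩ row + (r + ∑farDeg))
      ≤⟨ +-mono-≤ (+-mono-≤ row-v≤r ∑⟨near⟩rows≤) ∑⟨far⟩rows≤ ⟩
    r + ((Δ ∸ 2) * nearEdges + (r + ∑farDeg)) + (r + farToNear + r * r)
      ≡⟨ regroup r ((Δ ∸ 2) * nearEdges) (r + ∑farDeg) (r + farToNear + r * r) ⟩
    r + (Δ ∸ 2) * nearEdges + (r + farToNear + r * r) + (r + ∑farDeg) ∎)
    where
    open ≤-Reasoning
    regroup : ∀ a b c d → a + (b + c) + d ≡ a + b + d + c
    regroup = solve-∀

  farToNear≤r*Δ : farToNear ≤ r * Δ
  farToNear≤r*Δ = begin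
    farToNear
      ≤⟨ ∑⟨⟩-mono-≤ far (λ y _ → ∑⟨near⟩≤Δ (paws≤1 y)) ⟩
    ∑⟨ far ⟩ (λ _ → Δ)
      ≡⟨ ∑⟨⟩-const far Δ ⟩
    r * Δ ∎
    where open ≤-Reasoning

  -- If r ≤ 1, all neighbours of a far vertex y lie in N(v), so any triangle through y would give
  -- the two vertices v and y two common neighbours.
  farToNear≡0 : r ≤ 1 → farToNear ≡ 0
  farToNear≡0 r≤1 = ∑⟨⟩-zero far λ y y-far → ∑⟨⟩-zero near λ z _ → paws≡0 λ a c p →
    proj₁ (far-elim y-far) (sym (unique (~-irrefl (Paw.a~c p))
      (~-sym (inside y-far (~-sym (Paw.a~y p)))) (~-sym (inside y-far (Paw.y~c p)))
      (Paw.a~y p) (~-sym (Paw.y~c p))))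
    where
    inside : ∀ {y x} → far y ≡ true → y ~ x → v ~ x
    inside {y} {x} y-far y~x with position x
    ... | centre refl = contradiction (trans (sym (~-sym y~x)) (proj₂ (far-elim y-far))) λ ()
    ... | is-near v~x = v~x
    ... | is-far x-far = contradiction (≤-trans (two-terms≤∑ (𝟙 ∘ far) (~-irrefl y~x)) r≤1)
                           (subst₂ (λ a b → ¬ 𝟙 a + 𝟙 b ≤ 1) (sym y-far) (sym x-far) λ { (s≤s ()) })

  nearEdges≤Δ : nearEdges ≤ Δ
  nearEdges≤Δ = begin
    nearEdges            ≤⟨ ∑⟨⟩-mono-≤ near (λ y v~y → codeg≤1 (~-irrefl v~y)) ⟩
    ∑⟨ near ⟩ (λ _ → 1)  ≡⟨ ∑⟨near⟩1≡Δ ⟩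
    Δ                    ∎
    where open ≤-Reasoning

  nearEdges-even : ∃ λ k → nearEdges ≡ 2 * k
  nearEdges-even = map₂ (trans nearEdges≡∑∑) (∑∑-symmetric-even edge symmetric (λ y → diagonal y))
    where
    edge : Fin n → Fin n → ℕ
    edge y c = 𝟙 (adj G v y) * (𝟙 (adj G v c) * 𝟙 (adj G y c))
    nearEdges≡∑∑ : nearEdges ≡ ∑[ y < n ] ∑[ c < n ] edge y c
    nearEdges≡∑∑ = sum-cong-≗ λ y → *-distribˡ-sum (𝟙 (adj G v y)) (λ c → 𝟙 (adj G v c) * 𝟙 (adj G y c))
    swap : ∀ a b c → a * (b * c) ≡ b * (a * c)
    swap = solve-∀
    symmetric : ∀ y c → edge y c ≡ edge c y
    symmetric y c = trans (cong (λ b → 𝟙 (adj G v y) * (𝟙 (adj G v c) * 𝟙 b)) (Graph.sym G y c))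
                          (swap (𝟙 (adj G v y)) (𝟙 (adj G v c)) (𝟙 (adj G c y)))
    diagonal : ∀ y → edge y y ≡ 0
    diagonal y rewrite irrefl G y =
      trans (cong (𝟙 (adj G v y) *_) (*-zeroʳ (𝟙 (adj G v y)))) (*-zeroʳ (𝟙 (adj G v y)))

embCount≤pawCount : ∀ {n} (G : Graph n) → Free C₄ G → 54 ≤ n → embCount T₁ G ≤ pawCount n
embCount≤pawCount {n} G free 54≤n =
  subst (_≤ pawCount n) (sym embCount≡∑paws) (by-maximum-degree (all? (λ x → deg x ≤? 7)))
  where
  open Adjacency G
  open Paws G
  by-maximum-degree : Dec (∀ x → deg x ≤ 7) → ∑[ y < n ] ∑[ z < n ] paws y z ≤ pawCount n
  by-maximum-degree (yes deg≤7) = ≤-trans (C₄-free.∑paws≤n*[m*m] G free 7 deg≤7) (n*[m*m]≤pawCount 7 n 54≤n)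
  by-maximum-degree (no ¬deg≤7) = begin
    ∑[ y < n ] row y                                    ≤⟨ ∑rows≤ ⟩
    r + (Δ ∸ 2) * nearEdges + (r + farToNear + r * r)  ≤⟨ blocks≤pawCount Δ r nearEdges farToNear (≰⇒> deg≰7)
                                                             nearEdges≤Δ nearEdges-even farToNear≤r*Δ farToNear≡0 ⟩
    pawCount (1 + Δ + r)                                ≡⟨ cong pawCount n≡1+Δ+r ⟨
    pawCount n                                          ∎
    where
    open ≤-Reasoning
    v : Fin n
    v = proj₁ (¬∀⟶∃¬ n _ (λ x → deg x ≤? 7) ¬deg≤7)
    deg≰7 : deg v ≰ 7
    deg≰7 = proj₂ (¬∀⟶∃¬ n _ (λ x → deg x ≤? 7) ¬deg≤7)
    open AroundVertex G free v

-- The friendship graph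

same-half-same-parity : ∀ {p q} → p / 2 ≡ q / 2 → p % 2 ≡ q % 2 → p ≡ q
same-half-same-parity {p} {q} h≡ r≡ =
  trans (m≡m%n+[m/n]*n p 2) (trans (cong₂ (λ a b → a + b * 2) r≡ h≡) (sym (m≡m%n+[m/n]*n q 2)))

m%2≡0⊎m%2≡1 : ∀ m → m % 2 ≡ 0 ⊎ m % 2 ≡ 1
m%2≡0⊎m%2≡1 m with m % 2 | m%n<n m 2
... | 0           | _              = inj₁ refl
... | 1           | _              = inj₂ refl
... | suc (suc _) | s≤s (s≤s ())

no-three-with-same-half : ∀ {p q s} → p / 2 ≡ q / 2 → p / 2 ≡ s / 2 → p ≢ q → p ≢ s → q ≢ s → ⊥
no-three-with-same-half {p} {q} {s} pq ps p≢q p≢s q≢s with m%2≡0⊎m%2≡1 p | m%2≡0⊎m%2≡1 q | m%2≡0⊎m%2≡1 s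
... | inj₁ a | inj₁ b | _      = p≢q (same-half-same-parity pq (trans a (sym b)))
... | inj₂ a | inj₂ b | _      = p≢q (same-half-same-parity pq (trans a (sym b)))
... | inj₁ a | _      | inj₁ c = p≢s (same-half-same-parity ps (trans a (sym c)))
... | inj₂ a | _      | inj₂ c = p≢s (same-half-same-parity ps (trans a (sym c)))
... | inj₁ _ | inj₂ b | inj₂ c = q≢s (same-half-same-parity (trans (sym pq) ps) (trans b (sym c)))
... | inj₂ _ | inj₁ b | inj₁ c = q≢s (same-half-same-parity (trans (sym pq) ps) (trans b (sym c)))

[2+m]/2≡1+m/2 : ∀ m → (2 + m) / 2 ≡ 1 + m / 2
[2+m]/2≡1+m/2 m = m/n≡1+[m∸n]/n {2 + m} {2} (s≤s (s≤s z≤n))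

-- In F the rim vertex suc i is matched with suc (mate i).
mate : ℕ → ℕ
mate 0             = 1
mate 1             = 0
mate (suc (suc i)) = suc (suc (mate i))

mate-half : ∀ i → mate i / 2 ≡ i / 2
mate-half 0             = refl
mate-half 1             = refl
mate-half (suc (suc i)) = trans ([2+m]/2≡1+m/2 (mate i)) (trans (cong suc (mate-half i)) (sym ([2+m]/2≡1+m/2 i)))

mate-≢ : ∀ i → mate i ≢ i
mate-≢ (suc (suc i)) e = mate-≢ i (suc-injective (suc-injective e))

∑-mated : ∀ m → ∑[ i < m ] 𝟙 (mate (toℕ i) <ᵇ m) ≡ 2 * (m / 2)
∑-mated 0             = refl
∑-mated 1             = refl
∑-mated (suc (suc m)) = begin
  2 + ∑[ i < m ] 𝟙 (mate (toℕ i) <ᵇ m)   ≡⟨ cong (2 +_) (∑-mated m) ⟩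
  2 + 2 * (m / 2)                        ≡⟨ *-distribˡ-+ 2 1 (m / 2) ⟨
  2 * (1 + m / 2)                        ≡⟨ cong (2 *_) ([2+m]/2≡1+m/2 m) ⟨
  2 * ((2 + m) / 2)                      ∎
  where open ≡-Reasoning

mkGraph-adj⁺ : ∀ {n} (E : ℕ → ℕ → Bool) (i j : Fin n) → i ≢ j → E (toℕ i) (toℕ j) ≡ true →
               adj (mkGraph E) i j ≡ true
mkGraph-adj⁺ E i j i≢j e =
  cong₂ (λ a b → not a ∧ (b ∨ E (toℕ j) (toℕ i))) (trans (isYes≗does (i ≟ j)) (dec-false (i ≟ j) i≢j)) e

mkGraph-adj⁻ : ∀ {n} (E : ℕ → ℕ → Bool) (i j : Fin n) → adj (mkGraph E) i j ≡ true →
               E (toℕ i) (toℕ j) ≡ true ⊎ E (toℕ j) (toℕ i) ≡ true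
mkGraph-adj⁻ E i j e with Equivalence.to T-∨ (proj₂ (Equivalence.to T-∧ (Equivalence.from T-≡ e)))
... | inj₁ t = inj₁ (Equivalence.to T-≡ t)
... | inj₂ t = inj₂ (Equivalence.to T-≡ t)

module FriendshipGraph (m : ℕ) where

  open Adjacency (F (suc m))
  open Paws (F (suc m))

  hub~ : ∀ x → x ≢ zero → zero ~ x
  hub~ zero    x≢0 = contradiction refl x≢0
  hub~ (suc x) _   = mkGraph-adj⁺ friendE zero (suc x) (λ ()) refl

  same-half⇒~ : ∀ (i j : Fin m) → toℕ i ≢ toℕ j → toℕ i / 2 ≡ toℕ j / 2 → suc i ~ suc j
  same-half⇒~ i j i≢j same = mkGraph-adj⁺ friendE (suc i) (suc j) (i≢j ∘ cong toℕ ∘ Finₚ.suc-injective)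
                                          (Equivalence.to T-≡ (≡⇒≡ᵇ _ _ same))

  ~⇒same-half : ∀ (i j : Fin m) → suc i ~ suc j → toℕ i / 2 ≡ toℕ j / 2
  ~⇒same-half i j e with mkGraph-adj⁻ friendE (suc i) (suc j) e
  ... | inj₁ t = ≡ᵇ⇒≡ _ _ (Equivalence.from T-≡ t)
  ... | inj₂ t = sym (≡ᵇ⇒≡ _ _ (Equivalence.from T-≡ t))

  at-most-one-rim-neighbour : ∀ x y z → x ~ y → x ~ z → y ≢ z → x ≡ zero ⊎ y ≡ zero ⊎ z ≡ zero
  at-most-one-rim-neighbour zero    _       _       _   _   _   = inj₁ refl
  at-most-one-rim-neighbour (suc _) zero    _       _   _   _   = inj₂ (inj₁ refl)
  at-most-one-rim-neighbour (suc _) (suc _) zero    _   _   _   = inj₂ (inj₂ refl)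
  at-most-one-rim-neighbour (suc x) (suc y) (suc z) x~y x~z y≢z =
    ⊥-elim (no-three-with-same-half (~⇒same-half x y x~y) (~⇒same-half x z x~z)
             (distinct (~-irrefl {suc x} {suc y} x~y)) (distinct (~-irrefl {suc x} {suc z} x~z)) (distinct y≢z))
    where
    distinct : ∀ {i j : Fin m} → suc i ≢ suc j → toℕ i ≢ toℕ j
    distinct si≢sj = si≢sj ∘ cong suc ∘ toℕ-injective

  hub-commonNeighbours : ∀ w c c′ → zero ≢ w → zero ~ c → w ~ c → zero ~ c′ → w ~ c′ → c ≡ c′
  hub-commonNeighbours w c c′ 0≢w 0~c w~c 0~c′ w~c′ with c ≟ c′
  ... | yes c≡c′ = c≡c′
  ... | no  c≢c′ with at-most-one-rim-neighbour w c c′ w~c w~c′ c≢c′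
  ...   | inj₁ w≡0         = contradiction (sym w≡0) 0≢w
  ...   | inj₂ (inj₁ c≡0)  = contradiction (sym c≡0) (~-irrefl {zero} {c} 0~c)
  ...   | inj₂ (inj₂ c′≡0) = contradiction (sym c′≡0) (~-irrefl {zero} {c′} 0~c′)

  uniqueCommonNeighbours : UniqueCommonNeighbours
  uniqueCommonNeighbours {y} {z} {c} {c′} y≢z y~c z~c y~c′ z~c′ with c ≟ c′
  ... | yes c≡c′ = c≡c′
  ... | no  c≢c′ with at-most-one-rim-neighbour c y z (~-sym {y} {c} y~c) (~-sym {z} {c} z~c) y≢z
                     | at-most-one-rim-neighbour c′ y z (~-sym {y} {c′} y~c′) (~-sym {z} {c′} z~c′) y≢z
  ...   | inj₁ c≡0         | inj₁ c′≡0        = contradiction (trans c≡0 (sym c′≡0)) c≢c′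
  ...   | inj₂ (inj₁ refl) | _                = hub-commonNeighbours z c c′ y≢z y~c z~c y~c′ z~c′
  ...   | _                | inj₂ (inj₁ refl) = hub-commonNeighbours z c c′ y≢z y~c z~c y~c′ z~c′
  ...   | inj₂ (inj₂ refl) | _                = hub-commonNeighbours y c c′ (y≢z ∘ sym) z~c y~c z~c′ y~c′
  ...   | _                | inj₂ (inj₂ refl) = hub-commonNeighbours y c c′ (y≢z ∘ sym) z~c y~c z~c′ y~c′

  row : Fin (suc m) → ℕ
  row a = ∑[ b < suc m ] ∑[ c < suc m ] ∑[ x < suc m ] 𝟙 (isEmb T₁ (F (suc m)) ⟨ a , b , c , x ⟩)

  mated-row : ∀ (i : Fin m) → T (mate (toℕ i) <ᵇ m) → suc m ∸ 3 ≤ row (suc i)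
  mated-row i mated = begin
    suc m ∸ 3
      ≤⟨ ∑-except₃ (emb (suc j) zero) zero (suc i) (suc j) pendant ⟩
    ∑[ x < suc m ] emb (suc j) zero x
      ≤⟨ term≤∑ (λ c → ∑[ x < suc m ] emb (suc j) c x) zero ⟩
    ∑[ c < suc m ] ∑[ x < suc m ] emb (suc j) c x
      ≤⟨ term≤∑ (λ b → ∑[ c < suc m ] ∑[ x < suc m ] emb b c x) (suc j) ⟩
    row (suc i) ∎
    where
    open ≤-Reasoning
    emb : Fin (suc m) → Fin (suc m) → Fin (suc m) → ℕ
    emb b c x = 𝟙 (isEmb T₁ (F (suc m)) ⟨ suc i , b , c , x ⟩)
    j : Fin m
    j = fromℕ< (<ᵇ⇒< _ _ mated)
    j≡mate : toℕ j ≡ mate (toℕ i)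
    j≡mate = toℕ-fromℕ< (<ᵇ⇒< _ _ mated)
    i~j : suc i ~ suc j
    i~j = same-half⇒~ i j (λ i≡j → mate-≢ (toℕ i) (trans (sym j≡mate) (sym i≡j)))
                         (sym (trans (cong (_/ 2) j≡mate) (mate-half (toℕ i))))
    pendant : ∀ x → x ≢ zero → x ≢ suc i → x ≢ suc j → 0 < emb (suc j) zero x
    pendant x x≢0 x≢i x≢j = ≤-reflexive (sym (cong 𝟙 (Paw⇒isEmb (suc i) (suc j) zero x record
      { a~y = i~j
      ; y~c = ~-sym {zero} {suc j} (hub~ (suc j) λ ())
      ; a~c = ~-sym {zero} {suc i} (hub~ (suc i) λ ())
      ; c~z = hub~ x x≢0
      ; z≢a = x≢i
      ; z≢y = x≢j
      })))

  pawCount≤embCount : pawCount (suc m) ≤ embCount T₁ (F (suc m))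
  pawCount≤embCount = begin
    2 * (m / 2) * (suc m ∸ 3)
      ≡⟨ cong (_* (suc m ∸ 3)) (∑-mated m) ⟨
    (∑[ i < m ] 𝟙 (mate (toℕ i) <ᵇ m)) * (suc m ∸ 3)
      ≡⟨ *-distribʳ-sum {m} (suc m ∸ 3) (λ i → 𝟙 (mate (toℕ i) <ᵇ m)) ⟩
    ∑[ i < m ] (𝟙 (mate (toℕ i) <ᵇ m) * (suc m ∸ 3))
      ≤⟨ ∑-mono-≤ mated-rows ⟩
    ∑[ i < m ] row (suc i)
      ≤⟨ m≤n+m _ (row zero) ⟩
    ∑[ a < suc m ] row a
      ≡⟨ embCount≡∑⁴ T₁ (F (suc m)) ⟨
    embCount T₁ (F (suc m)) ∎
    where
    open ≤-Reasoning
    mated-rows : ∀ i → 𝟙 (mate (toℕ i) <ᵇ m) * (suc m ∸ 3) ≤ row (suc i)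
    mated-rows i with mate (toℕ i) <ᵇ m in mated
    ... | false = z≤n
    ... | true  = ≤-trans (≤-reflexive (+-identityʳ _)) (mated-row i (Equivalence.from T-≡ mated))

F-C₄-free : ∀ n → Free C₄ (F n)
F-C₄-free zero    = isEmb-never⇒embCount≡0 C₄ (F zero) λ ()
F-C₄-free (suc m) = Adjacency.uniqueCommonNeighbours⇒C₄-free (F (suc m)) (FriendshipGraph.uniqueCommonNeighbours m)

pawCount≤embCount-F : ∀ n → pawCount n ≤ embCount T₁ (F n)
pawCount≤embCount-F zero    = z≤n
pawCount≤embCount-F (suc m) = FriendshipGraph.pawCount≤embCount m

embCount-F : ∀ n → 54 ≤ n → embCount T₁ (F n) ≡ pawCount n
embCount-F n 54≤n = ≤-antisym (embCount≤pawCount (F n) (F-C₄-free n) 54≤n) (pawCount≤embCount-F n)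

-- Closed forms

-- The paw has exactly two automorphisms.
N≡embCount/2 : ∀ {n} (G : Graph n) → N T₁ G ≡ embCount T₁ G / 2
N≡embCount/2 G = refl

[nC2]*2≡n*[n∸1] : ∀ n → (n C 2) * 2 ≡ n * (n ∸ 1)
[nC2]*2≡n*[n∸1] zero    = refl
[nC2]*2≡n*[n∸1] (suc n) = begin
  (suc n C 2) * 2       ≡⟨ cong (_* 2) (trans (sym (nCk+nC[k+1]≡[n+1]C[k+1] n 1)) (cong (_+ n C 2) (nC1≡n n))) ⟩
  (n + n C 2) * 2       ≡⟨ *-distribʳ-+ 2 n (n C 2) ⟩
  n * 2 + (n C 2) * 2   ≡⟨ cong (n * 2 +_) ([nC2]*2≡n*[n∸1] n) ⟩
  n * 2 + n * (n ∸ 1)   ≡⟨ step n ⟩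
  suc n * n             ∎
  where
  open ≡-Reasoning
  expand : ∀ k → suc k * 2 + suc k * k ≡ suc (suc k) * suc k
  expand = solve-∀
  step : ∀ n → n * 2 + n * (n ∸ 1) ≡ suc n * n
  step zero    = refl
  step (suc k) = expand k

half-of-double : ∀ m k → m ≡ k * 2 → m / 2 ≡ k
half-of-double m k refl = m*n/n≡m k 2

half-of-odd : ∀ k → (1 + k * 2) / 2 ≡ k
half-of-odd zero    = refl
half-of-odd (suc k) = trans ([2+m]/2≡1+m/2 (1 + k * 2)) (cong suc (half-of-odd k))

pawCount-odd : ∀ q → pawCount (1 + q * 2) / 2 ≡ (1 + q * 2) C 2 ∸ (3 * (q * 2)) / 2
pawCount-odd zero    = refl
pawCount-odd (suc p) = begin
  pawCount n / 2                 ≡⟨ cong (λ h → 2 * h * (p * 2) / 2) (m*n/n≡m q 2) ⟩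
  2 * q * (p * 2) / 2            ≡⟨ half-of-double _ (q * (p * 2)) (double q (p * 2)) ⟩
  q * (p * 2)                    ≡⟨ m+n∸m≡n (3 * q) (q * (p * 2)) ⟨
  3 * q + q * (p * 2) ∸ 3 * q    ≡⟨ cong₂ _∸_ binomial (half-of-double _ (3 * q) (sym (*-assoc 3 q 2))) ⟨
  n C 2 ∸ (3 * (q * 2)) / 2      ∎
  where
  open ≡-Reasoning
  q n : ℕ
  q = suc p
  n = 1 + q * 2
  double : ∀ a b → 2 * a * b ≡ a * b * 2
  double = solve-∀
  expand : ∀ p → (1 + suc p * 2) * (suc p * 2) ≡ (3 * suc p + suc p * (p * 2)) * 2
  expand = solve-∀
  binomial : n C 2 ≡ 3 * q + q * (p * 2)
  binomial = *-cancelʳ-≡ _ _ 2 (trans ([nC2]*2≡n*[n∸1] n) (expand p))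

pawCount-even : ∀ p → pawCount ((3 + p) * 2) / 2 ≡ (3 + p) * 2 C 2 ∸ 2 * ((3 + p) * 2) + 3
pawCount-even p = begin
  pawCount n / 2                  ≡⟨ cong (λ h → 2 * h * (3 + p * 2) / 2) (half-of-odd (2 + p)) ⟩
  2 * (2 + p) * (3 + p * 2) / 2   ≡⟨ half-of-double _ ((2 + p) * (3 + p * 2)) (double (2 + p) (3 + p * 2)) ⟩
  (2 + p) * (3 + p * 2)           ≡⟨ expand p ⟩
  rest + 3                        ≡⟨ cong (_+ 3) (m+n∸m≡n (2 * n) rest) ⟨
  2 * n + rest ∸ 2 * n + 3        ≡⟨ cong (λ c → c ∸ 2 * n + 3) binomial ⟨
  n C 2 ∸ 2 * n + 3               ∎
  where
  open ≡-Reasoning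
  n rest : ℕ
  n = (3 + p) * 2
  rest = 3 + 7 * p + p * p * 2
  double : ∀ a b → 2 * a * b ≡ a * b * 2
  double = solve-∀
  expand : ∀ p → (2 + p) * (3 + p * 2) ≡ 3 + 7 * p + p * p * 2 + 3
  expand = solve-∀
  expand₂ : ∀ p → (3 + p) * 2 * (1 + (2 + p) * 2) ≡ (2 * ((3 + p) * 2) + (3 + 7 * p + p * p * 2)) * 2
  expand₂ = solve-∀
  binomial : n C 2 ≡ 2 * n + rest
  binomial = *-cancelʳ-≡ _ _ 2 (trans ([nC2]*2≡n*[n∸1] n) (expand₂ p))

N-F-odd : ∀ n → 54 ≤ n → n % 2 ≡ 1 → N T₁ (F n) ≡ n C 2 ∸ (3 * (n ∸ 1)) / 2
N-F-odd n 54≤n odd = begin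
  N T₁ (F n)                     ≡⟨ N≡embCount/2 (F n) ⟩
  embCount T₁ (F n) / 2          ≡⟨ cong (_/ 2) (embCount-F n 54≤n) ⟩
  pawCount n / 2                 ≡⟨ subst (λ k → pawCount k / 2 ≡ k C 2 ∸ (3 * (k ∸ 1)) / 2) (sym n≡1+q*2)
                                          (pawCount-odd (n / 2)) ⟩
  n C 2 ∸ (3 * (n ∸ 1)) / 2      ∎
  where
  open ≡-Reasoning
  n≡1+q*2 : n ≡ 1 + n / 2 * 2
  n≡1+q*2 = trans (m≡m%n+[m/n]*n n 2) (cong (_+ n / 2 * 2) odd)

N-F-even : ∀ n → 54 ≤ n → n % 2 ≡ 0 → N T₁ (F n) ≡ n C 2 ∸ 2 * n + 3
N-F-even n 54≤n even with m≤n⇒∃[o]m+o≡n (/-monoˡ-≤ 2 (≤-trans (m≤m+n 6 48) 54≤n))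
... | p , 3+p≡n/2 = begin
  N T₁ (F n)                     ≡⟨ N≡embCount/2 (F n) ⟩
  embCount T₁ (F n) / 2          ≡⟨ cong (_/ 2) (embCount-F n 54≤n) ⟩
  pawCount n / 2                 ≡⟨ subst (λ k → pawCount k / 2 ≡ k C 2 ∸ 2 * k + 3) (sym n≡[3+p]*2)
                                          (pawCount-even p) ⟩
  n C 2 ∸ 2 * n + 3              ∎
  where
  open ≡-Reasoning
  n≡[3+p]*2 : n ≡ (3 + p) * 2
  n≡[3+p]*2 = trans (m≡m%n+[m/n]*n n 2) (cong₂ (λ a b → a + b * 2) even (sym 3+p≡n/2))

theorem3p11 : ∃ λ n₀ → ∀ n → n₀ ≤ n →
    ((∀ (G : Graph n) → Free C₄ G → N T₁ G ≤ N T₁ (F n))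
    × Free C₄ (F n))
    × (n % 2 ≡ 1 → N T₁ (F n) ≡ n C 2 ∸ (3 * (n ∸ 1)) / 2)
    × (n % 2 ≡ 0 → N T₁ (F n) ≡ n C 2 ∸ 2 * n + 3)
theorem3p11 = 54 , λ n 54≤n →
  ( (λ G free → /-monoˡ-≤ 2 (≤-trans (embCount≤pawCount G free 54≤n) (pawCount≤embCount-F n)))
  , F-C₄-free n )
  , N-F-odd n 54≤n
  , N-F-even n 54≤n
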